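{- Let $K$ be a number field and $\mathfrak{p}$ a finite place of $K$. Let $\phi,\psi\colon\mathbb{P}_1\to\mathbb{P}_1$ be rational maps defined over $K$, both with good reduction at $\mathfrak{p}$, and let $P,Q\in\mathbb{P}_1(K)$ be periodic points of $\psi\circ\phi$. Then $\delta_{\mathfrak{p}}(P,Q)=\delta_{\mathfrak{p}}(\phi(P),\phi(Q))$.
   Context: $\delta_{\mathfrak{p}}([x_1:y_1],[x_2:y_2])=\nu_{\mathfrak{p}}(x_1y_2-x_2y_1)-\min\{\nu_{\mathfrak{p}}(x_1),\nu_{\mathfrak{p}}(y_1)\}-\min\{\nu_{\mathfrak{p}}(x_2),\nu_{\mathfrak{p}}(y_2)\}$ with $\nu_{\mathfrak{p}}$ the normalized $\mathfrak{p}$-adic valuation ($\nu_{\mathfrak{p}}(0)=\infty$). Periodic: $f^n(P)=P$ for some $n\geq1$. Good reduction at $\mathfrak{p}$: the map is $[F:G]$ with $F,G\in R_{\mathfrak{p}}[X,Y]$ homogeneous of the map's degree with resultant a $\mathfrak{p}$-unit. -}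

module Defs where

open import Level using (Level; _⊔_) renaming (suc to lsuc)
open import Algebra.Bundles using (CommutativeRing)
open import Data.Nat as ℕ using (ℕ; zero; suc; _∸_)
open import Data.Nat.Properties using (_<?_; _≤?_)
open import Data.Integer as ℤ using (ℤ; +_)
open import Data.Rational as ℚ using (ℚ; 0ℚ; 1ℚ)
open import Data.Fin as Fin using (Fin; toℕ; fromℕ<; punchIn)
open import Data.Product using (Σ; _×_; _,_)
open import Relation.Nullary using (¬_; yes; no)
open import Relation.Binary.PropositionalEquality using (_≡_)

data ℤ∞ : Set where
  fin : ℤ → ℤ∞
  ∞   : ℤ∞

_+∞_ : ℤ∞ → ℤ∞ → ℤ∞
fin a +∞ fin b = fin (a ℤ.+ b)
_     +∞ _     = ∞

-- a - b; only used with b finite (b = ∞ only for the excluded zero pair)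
_-∞_ : ℤ∞ → ℤ∞ → ℤ∞
fin a -∞ fin b = fin (a ℤ.- b)
_     -∞ _     = ∞

min∞ : ℤ∞ → ℤ∞ → ℤ∞
min∞ (fin a) (fin b) = fin (a ℤ.⊓ b)
min∞ (fin a) ∞       = fin a
min∞ ∞       b       = b

data _≤∞_ : ℤ∞ → ℤ∞ → Set where
  fin≤fin : ∀ {a b} → a ℤ.≤ b → fin a ≤∞ fin b
  _≤∞∞    : ∀ a → a ≤∞ ∞

ringSum : ∀ {c ℓ} (R : CommutativeRing c ℓ) (n : ℕ) →
          (Fin n → CommutativeRing.Carrier R) → CommutativeRing.Carrier R
ringSum R zero    f = CommutativeRing.0# R
ringSum R (suc n) f = CommutativeRing._+_ R (f Fin.zero) (ringSum R n (λ i → f (Fin.suc i)))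

record NumberField (c ℓ : Level) : Set (lsuc (c ⊔ ℓ)) where
  field
    commRing : CommutativeRing c ℓ
  open CommutativeRing commRing public

  field
    0≉1     : ¬ (0# ≈ 1#)
    inverse : ∀ x → ¬ (x ≈ 0#) → Σ Carrier (λ y → (x * y) ≈ 1#)
    ι       : ℚ → Carrier
    ι-1     : ι 1ℚ ≈ 1#
    ι-+     : ∀ p q → ι (p ℚ.+ q) ≈ (ι p + ι q)
    ι-*     : ∀ p q → ι (p ℚ.* q) ≈ (ι p * ι q)
    dim     : ℕ
    basis   : Fin dim → Carrier
    spans   : ∀ x → Σ (Fin dim → ℚ) (λ a → x ≈ ringSum commRing dim (λ i → ι (a i) * basis i))
    indep   : ∀ (a : Fin dim → ℚ) → ringSum commRing dim (λ i → ι (a i) * basis i) ≈ 0# →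
              ∀ i → a i ≡ 0ℚ

-- Finite places, given by their normalized discrete valuation
-- ν_𝔭 : K → ℤ ∪ {∞} (surjective onto ℤ, i.e. normalized).

record FinitePlace {c ℓ} (K : NumberField c ℓ) : Set (c ⊔ ℓ) where
  open NumberField K
  field
    ν       : Carrier → ℤ∞
    ν-cong  : ∀ {x y} → x ≈ y → ν x ≡ ν y
    ν-∞⇒0   : ∀ x → ν x ≡ ∞ → x ≈ 0#
    ν-0     : ν 0# ≡ ∞
    ν-*     : ∀ x y → ν (x * y) ≡ (ν x +∞ ν y)
    ν-+     : ∀ x y → min∞ (ν x) (ν y) ≤∞ ν (x + y)
    ν-surj  : ∀ (n : ℤ) → Σ Carrier (λ x → ν x ≡ fin n)

module _ {c ℓ} (K : NumberField c ℓ) where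
  open NumberField K

  sumF : (n : ℕ) → (Fin n → Carrier) → Carrier
  sumF = ringSum commRing

  pow : Carrier → ℕ → Carrier
  pow x zero    = 1#
  pow x (suc n) = x * pow x n

  det : (n : ℕ) → (Fin n → Fin n → Carrier) → Carrier
  det zero    M = 1#
  det (suc n) M = sumF (suc n) (λ j →
      sgn (toℕ j) * (M Fin.zero j * det n (λ r s → M (Fin.suc r) (punchIn j s))))
    where
    sgn : ℕ → Carrier
    sgn zero          = 1#
    sgn (suc zero)    = - 1#
    sgn (suc (suc k)) = sgn k

  -- A binary form of degree D: a k = coefficient of X^(D-k) Y^k, 0 ≤ k ≤ D.
  Form : ℕ → Set c
  Form D = Fin (suc D) → Carrier

  coef : ∀ {D} → Form D → ℕ → Carrier
  coef {D} a k with k <? suc D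
  ... | yes k<D = a (fromℕ< k<D)
  ... | no  _   = 0#

  evalForm : ∀ {D} → Form D → Carrier → Carrier → Carrier
  evalForm {D} a x y = sumF (suc D) (λ k → a k * (pow x (D ∸ toℕ k) * pow y (toℕ k)))

  sylvester : ∀ {D} → Form D → Form D → Fin (D ℕ.+ D) → Fin (D ℕ.+ D) → Carrier
  sylvester {D} a b i j with toℕ i <? D
  ... | yes _ = shifted a (toℕ i)
    where
    shifted : Form D → ℕ → Carrier
    shifted f r with r ≤? toℕ j
    ... | yes _ = coef f (toℕ j ∸ r)
    ... | no  _ = 0#
  ... | no  _ = shifted b (toℕ i ∸ D)
    where
    shifted : Form D → ℕ → Carrier
    shifted f r with r ≤? toℕ j
    ... | yes _ = coef f (toℕ j ∸ r)
    ... | no  _ = 0#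

  Res : ∀ {D} → Form D → Form D → Carrier
  Res {D} a b = det (D ℕ.+ D) (sylvester a b)

  -- A rational map P¹ → P¹ over K of degree D = suc d ≥ 1: [F : G] with
  -- F, G binary forms of degree D with nonzero resultant.
  record RationalMap : Set (c ⊔ ℓ) where
    field
      d   : ℕ
      F G : Form (suc d)
      Res≉0 : ¬ (Res F G ≈ 0#)

  -- points of P¹(K) are represented by pairs (x , y) not both zero
  Pair : Set c
  Pair = Carrier × Carrier

  NonZeroPair : Pair → Set ℓ
  NonZeroPair (x , y) = ¬ ((x ≈ 0#) × (y ≈ 0#))

  _∼_ : Pair → Pair → Set ℓ
  (x₁ , y₁) ∼ (x₂ , y₂) = (x₁ * y₂) ≈ (x₂ * y₁)

  apply : RationalMap → Pair → Pair
  apply φ (x , y) = evalForm F x y , evalForm G x y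
    where open RationalMap φ

  iterate : (Pair → Pair) → ℕ → Pair → Pair
  iterate f zero    P = P
  iterate f (suc n) P = f (iterate f n P)

  Periodic : (Pair → Pair) → Pair → Set ℓ
  Periodic f P = Σ ℕ (λ n → iterate f (suc n) P ∼ P)

  module _ (𝔭 : FinitePlace K) where
    open FinitePlace 𝔭

    Integral : Carrier → Set
    Integral x = fin (+ 0) ≤∞ ν x

    GoodReduction : RationalMap → Set (c ⊔ ℓ)
    GoodReduction φ = Σ Carrier (λ s → ¬ (s ≈ 0#) ×
        (((k : Fin (suc (suc d))) → Integral (s * F k) × Integral (s * G k)) ×
         (ν (Res (λ k → s * F k) (λ k → s * G k)) ≡ fin (+ 0))))
      where open RationalMap φ

    δ : Pair → Pair → ℤ∞
    δ (x₁ , y₁) (x₂ , y₂) =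
      (ν ((x₁ * y₂) - (x₂ * y₁)) -∞ min∞ (ν x₁) (ν y₁)) -∞ min∞ (ν x₂) (ν y₂)

{-# OPTIONS --safe #-}
-- Scaling a representative by α ≠ 0 shifts both the cross term and the
-- minimum in δ_𝔭 by ν(α), so δ_𝔭 may be computed on normalized
-- representatives (min(ν x, ν y) = 0), where it is ν(x₁y₂ − x₂y₁).  If φ = [F:G]
-- has good reduction, F and G (suitably scaled) have integral coefficients and
-- unit resultant, hence cannot both vanish mod 𝔭 at a normalized point, since
-- Cramer's rule on the Sylvester matrix would put the resultant in 𝔭; so
-- normalized points map to normalized points.  Moreover Q ≡ λP modulo
-- x₁y₂ − x₂y₁, so homogeneity gives F(P)G(Q) − F(Q)G(P) ≡ 0 modulo the same
-- element.  Hence δ_𝔭(P,Q) ≤ δ_𝔭(φP,φQ) for every map with good reduction.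
-- Along the orbit of Φ = ψ ∘ φ this gives
-- δ_𝔭(P,Q) ≤ δ_𝔭(φP,φQ) ≤ δ_𝔭(ΦP,ΦQ) ≤ … ≤ δ_𝔭(Φᴺ P, Φᴺ Q),
-- and for N a common period of P and Q the last term is δ_𝔭(P,Q) again.
module Submission where

open import Defs
open import Level using (Level)
open import Relation.Binary.PropositionalEquality using (_≡_)

open import Data.Nat as ℕ using (ℕ; zero; suc; _∸_)
import Data.Nat.Properties as ℕ
open import Data.Integer as ℤ using (ℤ; +_)
import Data.Integer.Properties as ℤ
import Data.Integer.Solver as ℤ-Solver
import Data.Nat.Solver as ℕ-Solver
import Data.Rational as ℚ
import Data.Rational.Properties as ℚ
open import Data.Fin as Fin using (Fin; toℕ; punchIn; punchOut; inject₁)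
import Data.Fin.Properties as Fin
open import Data.Product using (Σ; ∃; _×_; _,_; proj₁; proj₂)
open import Data.Sum using (_⊎_; inj₁; inj₂)
open import Data.Empty using (⊥-elim)
open import Data.Maybe using (Maybe; just; nothing)
open import Relation.Nullary using (¬_; yes; no; Dec)
open import Relation.Binary.Definitions using (tri<; tri≈; tri>)
open import Relation.Binary.Bundles using (Poset)
import Relation.Binary.PropositionalEquality as ≡
import Algebra.Solver.Ring.AlmostCommutativeRing as ACR
import Algebra.Solver.Ring as RingSolver

module ℤ∞-Properties where

  fin-injective : ∀ {a b} → fin a ≡ fin b → a ≡ b
  fin-injective ≡.refl = ≡.refl

  ≤∞-refl : ∀ {a} → a ≤∞ a
  ≤∞-refl {fin a} = fin≤fin ℤ.≤-refl
  ≤∞-refl {∞}     = ∞ ≤∞∞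

  ≤∞-reflexive : ∀ {a b} → a ≡ b → a ≤∞ b
  ≤∞-reflexive ≡.refl = ≤∞-refl

  ≤∞-trans : ∀ {a b e} → a ≤∞ b → b ≤∞ e → a ≤∞ e
  ≤∞-trans (fin≤fin p) (fin≤fin q) = fin≤fin (ℤ.≤-trans p q)
  ≤∞-trans _           (_ ≤∞∞)     = _ ≤∞∞

  ≤∞-antisym : ∀ {a b} → a ≤∞ b → b ≤∞ a → a ≡ b
  ≤∞-antisym (fin≤fin p) (fin≤fin q) = ≡.cong fin (ℤ.≤-antisym p q)
  ≤∞-antisym (∞ ≤∞∞)     _           = ≡.refl

  ≤∞-poset : Poset _ _ _
  ≤∞-poset = record { isPartialOrder = record
    { isPreorder = record { isEquivalence = ≡.isEquivalence ; reflexive = ≤∞-reflexive ; trans = ≤∞-trans }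
    ; antisym    = ≤∞-antisym } }

  min∞-greatest : ∀ {e a b} → e ≤∞ a → e ≤∞ b → e ≤∞ min∞ a b
  min∞-greatest (fin≤fin p) (fin≤fin q) = fin≤fin (ℤ.⊓-glb p q)
  min∞-greatest (fin≤fin p) (_ ≤∞∞)     = fin≤fin p
  min∞-greatest (_ ≤∞∞)     q           = q

  min∞-≤ˡ : ∀ a b → min∞ a b ≤∞ a
  min∞-≤ˡ (fin a) (fin b) = fin≤fin (ℤ.i⊓j≤i a b)
  min∞-≤ˡ (fin a) ∞       = ≤∞-refl
  min∞-≤ˡ ∞       b       = _ ≤∞∞

  min∞-≤ʳ : ∀ a b → min∞ a b ≤∞ b
  min∞-≤ʳ (fin a) (fin b) = fin≤fin (ℤ.i⊓j≤j a b)
  min∞-≤ʳ (fin a) ∞       = _ ≤∞∞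
  min∞-≤ʳ ∞       b       = ≤∞-refl

  +∞-mono-≤∞ : ∀ {a a′ b b′} → a ≤∞ a′ → b ≤∞ b′ → (a +∞ b) ≤∞ (a′ +∞ b′)
  +∞-mono-≤∞ (fin≤fin p) (fin≤fin q) = fin≤fin (ℤ.+-mono-≤ p q)
  +∞-mono-≤∞ (fin≤fin p) (_ ≤∞∞)     = _ ≤∞∞
  +∞-mono-≤∞ (_ ≤∞∞)     (fin≤fin q) = _ ≤∞∞
  +∞-mono-≤∞ (_ ≤∞∞)     (_ ≤∞∞)     = _ ≤∞∞

  +∞-identityˡ : ∀ a → (fin (+ 0) +∞ a) ≡ a
  +∞-identityˡ (fin a) = ≡.cong fin (ℤ.+-identityˡ a)
  +∞-identityˡ ∞       = ≡.refl

  ≤∞-+∞-nonneg : ∀ {e a b} → fin (+ 0) ≤∞ a → e ≤∞ b → e ≤∞ (a +∞ b)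
  ≤∞-+∞-nonneg {e} p q = ≡.subst (_≤∞ _) (+∞-identityˡ e) (+∞-mono-≤∞ p q)

  +∞-distribˡ-min∞ : ∀ a u w → min∞ (fin a +∞ u) (fin a +∞ w) ≡ (fin a +∞ min∞ u w)
  +∞-distribˡ-min∞ a (fin u) (fin w) = ≡.cong fin (≡.sym (ℤ.mono-≤-distrib-⊓ (ℤ.+-monoʳ-≤ a) u w))
  +∞-distribˡ-min∞ a (fin u) ∞       = ≡.refl
  +∞-distribˡ-min∞ a ∞       (fin w) = ≡.refl
  +∞-distribˡ-min∞ a ∞       ∞       = ≡.refl

  +∞-unit⇒fin : ∀ {u w} → (u +∞ w) ≡ fin (+ 0) → ∃ λ b → w ≡ fin b
  +∞-unit⇒fin {fin a} {fin b} _ = b , ≡.refl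

  fin-+∞-infinite : ∀ g u → (fin g +∞ u) ≡ ∞ → u ≡ ∞
  fin-+∞-infinite g ∞ _ = ≡.refl

  -∞-shift : ∀ a b t c₁ c₂ →
    ((fin a +∞ (fin b +∞ t)) -∞ (fin a +∞ fin c₁)) -∞ (fin b +∞ fin c₂) ≡ ((t -∞ fin c₁) -∞ fin c₂)
  -∞-shift a b (fin t) c₁ c₂ = ≡.cong fin (solve 5 (λ a b t c₁ c₂ →
      ((a :+ (b :+ t)) :- (a :+ c₁)) :- (b :+ c₂) := (t :- c₁) :- c₂) ≡.refl a b t c₁ c₂)
    where open ℤ-Solver.+-*-Solver
  -∞-shift a b ∞       c₁ c₂ = ≡.refl

  -∞-zero : ∀ t → ((t -∞ fin (+ 0)) -∞ fin (+ 0)) ≡ t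
  -∞-zero (fin t) = ≡.cong fin (≡.trans (ℤ.+-identityʳ _) (ℤ.+-identityʳ t))
  -∞-zero ∞       = ≡.refl

  min∞-of-nonneg : ∀ u w → fin (+ 0) ≤∞ u → fin (+ 0) ≤∞ w →
    ¬ ((fin (+ 1) ≤∞ u) × (fin (+ 1) ≤∞ w)) → min∞ u w ≡ fin (+ 0)
  min∞-of-nonneg (fin (+ zero))  (fin q) _ (fin≤fin q≥0) _ = ≡.cong fin (ℤ.i≤j⇒i⊓j≡i q≥0)
  min∞-of-nonneg (fin (+ suc p)) (fin (+ zero)) _ _ _ = ≡.refl
  min∞-of-nonneg (fin (+ suc p)) (fin (+ suc q)) _ _ nb = ⊥-elim (nb (fin≤fin (ℤ.+≤+ ℕ.z<s) , fin≤fin (ℤ.+≤+ ℕ.z<s)))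
  min∞-of-nonneg (fin (+ zero))  ∞ _ _ _ = ≡.refl
  min∞-of-nonneg (fin (+ suc p)) ∞ _ _ nb = ⊥-elim (nb (fin≤fin (ℤ.+≤+ ℕ.z<s) , (_ ≤∞∞)))
  min∞-of-nonneg ∞ (fin (+ zero))  _ _ _ = ≡.refl
  min∞-of-nonneg ∞ (fin (+ suc q)) _ _ nb = ⊥-elim (nb ((_ ≤∞∞) , fin≤fin (ℤ.+≤+ ℕ.z<s)))
  min∞-of-nonneg ∞ ∞ _ _ nb = ⊥-elim (nb ((_ ≤∞∞) , (_ ≤∞∞)))
  min∞-of-nonneg (fin ℤ.-[1+ _ ]) _ (fin≤fin ()) _ _
  min∞-of-nonneg _ (fin ℤ.-[1+ _ ]) _ (fin≤fin ()) _

module Solver {c ℓ} (K : NumberField c ℓ) where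
  open NumberField K
  open import Algebra.Properties.Ring ring using (x+x≈x⇒x≈0; +-inverseˡ-unique)

  ι-0# : ι ℚ.0ℚ ≈ 0#
  ι-0# = x+x≈x⇒x≈0 _ (sym (ι-+ ℚ.0ℚ ℚ.0ℚ))

  ι-neg : ∀ p → ι (ℚ.- p) ≈ - ι p
  ι-neg p = +-inverseˡ-unique _ _ (trans (sym (ι-+ (ℚ.- p) p))
    (trans (reflexive (≡.cong ι (ℚ.+-inverseˡ p))) ι-0#))

  ι-homomorphism : ACR._-Raw-AlmostCommutative⟶_ ℚ.+-*-rawRing (ACR.fromCommutativeRing commRing)
  ι-homomorphism = record
    { ⟦_⟧    = ι
    ; +-homo = ι-+
    ; *-homo = ι-*
    ; -‿homo = ι-neg
    ; 0-homo = ι-0#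
    ; 1-homo = ι-1
    }

  ι-≟ : ∀ p q → Maybe (ι p ≈ ι q)
  ι-≟ p q with p ℚ.≟ q
  ... | yes p≡q = just (reflexive (≡.cong ι p≡q))
  ... | no  _   = nothing

  open RingSolver ℚ.+-*-rawRing (ACR.fromCommutativeRing commRing) ι-homomorphism ι-≟ public
    using (solve; _:=_; _:+_; _:*_; _:-_; :-_)

module Valuation {c ℓ} (K : NumberField c ℓ) (𝔭 : FinitePlace K) where
  open NumberField K
  open FinitePlace 𝔭
  open ℤ∞-Properties
  open import Algebra.Properties.Ring ring using (-1*x≈-x; -‿involutive; -‿distribˡ-*)

  ν-≈0 : ∀ {x} → x ≈ 0# → ν x ≡ ∞
  ν-≈0 x≈0 = ≡.trans (ν-cong x≈0) ν-0

  ν-finite : ∀ {x} → ¬ x ≈ 0# → ∃ λ a → ν x ≡ fin a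
  ν-finite {x} x≉0 with ν x in eq
  ... | fin a = a , ≡.refl
  ... | ∞     = ⊥-elim (x≉0 (ν-∞⇒0 x eq))

  ν-fin⇒≉0 : ∀ {x a} → ν x ≡ fin a → ¬ x ≈ 0#
  ν-fin⇒≉0 eq x≈0 with ≡.trans (≡.sym eq) (ν-≈0 x≈0)
  ... | ()

  ν-1# : ν 1# ≡ fin (+ 0)
  ν-1# with ν-finite {1#} (λ 1≈0 → 0≉1 (sym 1≈0))
  ... | a , eq = ≡.trans eq (≡.cong fin (identityˡ-unique a a (fin-injective (begin
      fin (a ℤ.+ a)     ≡⟨ ≡.cong₂ _+∞_ eq eq ⟨
      ν 1# +∞ ν 1#      ≡⟨ ν-* 1# 1# ⟨
      ν (1# * 1#)       ≡⟨ ν-cong (*-identityˡ 1#) ⟩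
      ν 1#              ≡⟨ eq ⟩
      fin a             ∎))))
    where
    open ≡.≡-Reasoning
    open import Algebra.Properties.AbelianGroup ℤ.+-0-abelianGroup using (identityˡ-unique)

  ν-inverse : ∀ {x y} → x * y ≈ 1# → (ν x +∞ ν y) ≡ fin (+ 0)
  ν-inverse {x} {y} xy≈1 = ≡.trans (≡.sym (ν-* x y)) (≡.trans (ν-cong xy≈1) ν-1#)

  ν-neg : ∀ x → ν (- x) ≡ ν x
  ν-neg x = begin
      ν (- x)              ≡⟨ ν-cong (sym (-1*x≈-x x)) ⟩
      ν (- 1# * x)         ≡⟨ ν-* (- 1#) x ⟩
      ν (- 1#) +∞ ν x      ≡⟨ ≡.cong (_+∞ ν x) ν-[-1#] ⟩
      fin (+ 0) +∞ ν x     ≡⟨ +∞-identityˡ (ν x) ⟩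
      ν x                  ∎
    where
    open ≡.≡-Reasoning
    [-1#]²≈1# : - 1# * - 1# ≈ 1#
    [-1#]²≈1# = trans (sym (-‿distribˡ-* 1# (- 1#))) (trans (-‿cong (*-identityˡ _)) (-‿involutive 1#))
    double≡0⇒≡0 : ∀ a → a ℤ.+ a ≡ + 0 → a ≡ + 0
    double≡0⇒≡0 (+ zero) _ = ≡.refl
    ν-[-1#] : ν (- 1#) ≡ fin (+ 0)
    ν-[-1#] with ν (- 1#) in eq
    ... | fin a = ≡.cong fin (double≡0⇒≡0 a (fin-injective
                    (≡.trans (≡.cong₂ _+∞_ (≡.sym eq) (≡.sym eq)) (ν-inverse [-1#]²≈1#))))
    ... | ∞     = ⊥-elim (0≉1 (sym (trans (sym [-1#]²≈1#) (trans (*-congʳ (ν-∞⇒0 _ eq)) (zeroˡ _)))))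

  ≤ν-resp-≈ : ∀ {e x y} → x ≈ y → e ≤∞ ν x → e ≤∞ ν y
  ≤ν-resp-≈ x≈y p = ≤∞-trans p (≤∞-reflexive (ν-cong x≈y))

  ≤ν-0# : ∀ {e} → e ≤∞ ν 0#
  ≤ν-0# = ≤∞-trans (_ ≤∞∞) (≤∞-reflexive (≡.sym ν-0))

  ≤ν-+ : ∀ {e x y} → e ≤∞ ν x → e ≤∞ ν y → e ≤∞ ν (x + y)
  ≤ν-+ p q = ≤∞-trans (min∞-greatest p q) (ν-+ _ _)

  ≤ν-neg : ∀ {e x} → e ≤∞ ν x → e ≤∞ ν (- x)
  ≤ν-neg {x = x} p = ≤∞-trans p (≤∞-reflexive (≡.sym (ν-neg x)))

  ≤ν-- : ∀ {e x y} → e ≤∞ ν x → e ≤∞ ν y → e ≤∞ ν (x - y)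
  ≤ν-- p q = ≤ν-+ p (≤ν-neg q)

  ≤ν-*ˡ : ∀ {e x y} → Integral K 𝔭 x → e ≤∞ ν y → e ≤∞ ν (x * y)
  ≤ν-*ˡ p q = ≤∞-trans (≤∞-+∞-nonneg p q) (≤∞-reflexive (≡.sym (ν-* _ _)))

  ≤ν-*ʳ : ∀ {e x y} → e ≤∞ ν x → Integral K 𝔭 y → e ≤∞ ν (x * y)
  ≤ν-*ʳ p q = ≤ν-resp-≈ (*-comm _ _) (≤ν-*ˡ q p)

  ≤ν-sum : ∀ {e} n (f : Fin n → Carrier) → (∀ j → e ≤∞ ν (f j)) → e ≤∞ ν (sumF K n f)
  ≤ν-sum zero    f h = ≤ν-0#
  ≤ν-sum (suc n) f h = ≤ν-+ (h Fin.zero) (≤ν-sum n (λ j → f (Fin.suc j)) (λ j → h (Fin.suc j)))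

  integral-1# : Integral K 𝔭 1#
  integral-1# = ≤∞-reflexive (≡.sym ν-1#)

  integral-pow : ∀ {x} n → Integral K 𝔭 x → Integral K 𝔭 (pow K x n)
  integral-pow zero    p = integral-1#
  integral-pow (suc n) p = ≤ν-*ˡ p (integral-pow n p)

  ν-pow-unit : ∀ {x} n → ν x ≡ fin (+ 0) → ν (pow K x n) ≡ fin (+ 0)
  ν-pow-unit zero    _  = ν-1#
  ν-pow-unit (suc n) eq = ≡.trans (ν-* _ _) (≡.cong₂ _+∞_ eq (ν-pow-unit n eq))

  unit-inverse : ∀ {x} → ν x ≡ fin (+ 0) → Σ Carrier λ w → x * w ≈ 1# × Integral K 𝔭 w
  unit-inverse {x} eq with inverse x (ν-fin⇒≉0 eq)
  ... | w , xw≈1 = w , xw≈1 , ≤∞-reflexive (≡.sym (begin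
      ν w                     ≡⟨ +∞-identityˡ (ν w) ⟨
      fin (+ 0) +∞ ν w        ≡⟨ ≡.cong (_+∞ ν w) eq ⟨
      ν x +∞ ν w              ≡⟨ ν-inverse xw≈1 ⟩
      fin (+ 0)               ∎))
    where open ≡.≡-Reasoning

module Determinant {c ℓ} (K : NumberField c ℓ) where
  open NumberField K
  open Solver K
  open import Algebra.Properties.Ring ring using (-‿involutive; -0#≈0#; x+x≈x⇒x≈0)
  open import Relation.Binary.Reasoning.Setoid setoid

  Mat : ℕ → Set c
  Mat n = Fin n → Fin n → Carrier

  minor : ∀ {n} → Mat (suc n) → Fin (suc n) → Mat n
  minor M j r s = M (Fin.suc r) (punchIn j s)

  alternating : ℕ → Carrier
  alternating zero    = 1#
  alternating (suc k) = - alternating k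

  -- The sign used by Defs.det is local to its where block.  Unfolding det on
  -- the zero matrix, at sizes suc (suc m) and suc m, exposes it at even and
  -- odd offsets as the first components below.
  private
    zeroMat : ∀ {m} → Mat m
    zeroMat _ _ = 0#

    evenSign : Σ ((m : ℕ) → Fin m → Carrier) λ S → ∀ m → det K (suc (suc m)) zeroMat ≡
      1# * (0# * det K (suc m) zeroMat) + (- 1# * (0# * det K (suc m) zeroMat)
        + sumF K m (λ i → S m i * (0# * det K (suc m) zeroMat)))
    evenSign = _ , λ m → ≡.refl

    oddSign : Σ ((m : ℕ) → Fin m → Carrier) λ S → ∀ m → det K (suc m) zeroMat ≡
      1# * (0# * det K m zeroMat) + sumF K m (λ i → S m i * (0# * det K m zeroMat))
    oddSign = _ , λ m → ≡.refl

    sign-even : ∀ m (i : Fin m) → proj₁ evenSign m i ≈ alternating (toℕ i)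
    sign-odd  : ∀ m (i : Fin m) → proj₁ oddSign m i ≈ alternating (suc (toℕ i))
    sign-even (suc m) Fin.zero    = refl
    sign-even (suc m) (Fin.suc i) = sign-odd m i
    sign-odd  (suc m) Fin.zero    = refl
    sign-odd  (suc m) (Fin.suc i) = trans (sign-even m i) (sym (-‿involutive _))

  sum-cong : ∀ n {f g : Fin n → Carrier} → (∀ j → f j ≈ g j) → sumF K n f ≈ sumF K n g
  sum-cong zero    h = refl
  sum-cong (suc n) h = +-cong (h Fin.zero) (sum-cong n (λ j → h (Fin.suc j)))

  sum-+ : ∀ n (f g : Fin n → Carrier) → sumF K n (λ j → f j + g j) ≈ sumF K n f + sumF K n g
  sum-+ zero    f g = sym (+-identityˡ 0#)
  sum-+ (suc n) f g = trans (+-congˡ (sum-+ n _ _))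
    (solve 4 (λ a b x y → (a :+ b) :+ (x :+ y) := (a :+ x) :+ (b :+ y)) refl _ _ _ _)

  sum-*ˡ : ∀ n a (f : Fin n → Carrier) → sumF K n (λ j → a * f j) ≈ a * sumF K n f
  sum-*ˡ zero    a f = sym (zeroʳ a)
  sum-*ˡ (suc n) a f = trans (+-congˡ (sum-*ˡ n a _)) (sym (distribˡ a _ _))

  sum-zero : ∀ n (f : Fin n → Carrier) → (∀ j → f j ≈ 0#) → sumF K n f ≈ 0#
  sum-zero zero    f h = refl
  sum-zero (suc n) f h = trans (+-cong (h Fin.zero) (sum-zero n _ (λ j → h (Fin.suc j)))) (+-identityˡ 0#)

  sum-single : ∀ n (f : Fin n → Carrier) k → (∀ j → ¬ j ≡ k → f j ≈ 0#) → sumF K n f ≈ f k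
  sum-single (suc n) f Fin.zero    h = trans (+-congˡ (sum-zero n _ (λ j → h (Fin.suc j) λ ()))) (+-identityʳ _)
  sum-single (suc n) f (Fin.suc k) h = trans (+-congʳ (h Fin.zero λ ())) (trans (+-identityˡ _)
    (sum-single n _ k (λ j j≢k → h (Fin.suc j) (λ eq → j≢k (Fin.suc-injective eq)))))

  sum-pair : ∀ n (f : Fin n → Carrier) a b → ¬ a ≡ b →
    (∀ j → ¬ j ≡ a → ¬ j ≡ b → f j ≈ 0#) → sumF K n f ≈ f a + f b
  sum-pair (suc n) f Fin.zero    Fin.zero    a≢b h = ⊥-elim (a≢b ≡.refl)
  sum-pair (suc n) f Fin.zero    (Fin.suc b) a≢b h =
    +-congˡ (sum-single n _ b (λ j j≢b → h (Fin.suc j) (λ ()) (λ eq → j≢b (Fin.suc-injective eq))))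
  sum-pair (suc n) f (Fin.suc a) Fin.zero    a≢b h =
    trans (+-congˡ (sum-single n _ a (λ j j≢a → h (Fin.suc j) (λ eq → j≢a (Fin.suc-injective eq)) λ ())))
          (+-comm _ _)
  sum-pair (suc n) f (Fin.suc a) (Fin.suc b) a≢b h =
    trans (+-congʳ (h Fin.zero (λ ()) (λ ()))) (trans (+-identityˡ _)
      (sum-pair n _ a b (λ eq → a≢b (≡.cong Fin.suc eq))
        (λ j j≢a j≢b → h (Fin.suc j) (λ eq → j≢a (Fin.suc-injective eq)) (λ eq → j≢b (Fin.suc-injective eq)))))

  laplaceTerm : ∀ n → Mat (suc n) → Fin (suc n) → Carrier
  laplaceTerm n M j = alternating (toℕ j) * (M Fin.zero j * det K n (minor M j))

  det-laplace : ∀ n M → det K (suc n) M ≈ sumF K (suc n) (laplaceTerm n M)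
  det-laplace n M = sum-cong (suc n)
    {f = λ j → proj₁ evenSign (suc n) j * (M Fin.zero j * det K n (minor M j))} {g = laplaceTerm n M}
    (λ j → *-congʳ (sign-even (suc n) j))

  det-cong : ∀ n {A B : Mat n} → (∀ r s → A r s ≈ B r s) → det K n A ≈ det K n B
  det-cong zero    h = refl
  det-cong (suc n) {A} {B} h = trans (det-laplace n A) (trans (sum-cong (suc n) {f = laplaceTerm n A} {g = laplaceTerm n B} (λ j →
      *-congˡ (*-cong (h _ _) (det-cong n (λ r s → h _ _))))) (sym (det-laplace n B)))

  det-linear : ∀ n (A B C : Mat n) k a →
    (∀ r s → ¬ s ≡ k → A r s ≈ C r s) → (∀ r s → ¬ s ≡ k → B r s ≈ C r s) →
    (∀ r → C r k ≈ a * A r k + B r k) → det K n C ≈ a * det K n A + det K n B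
  det-linear (suc n) A B C k a hA hB hC = begin
      det K (suc n) C                                                          ≈⟨ det-laplace n C ⟩
      sumF K (suc n) (laplaceTerm n C)                                         ≈⟨ sum-cong (suc n) termwise ⟩
      sumF K (suc n) (λ j → a * laplaceTerm n A j + laplaceTerm n B j)         ≈⟨ sum-+ (suc n) (λ j → a * laplaceTerm n A j) (laplaceTerm n B) ⟩
      sumF K (suc n) (λ j → a * laplaceTerm n A j) + sumF K (suc n) (laplaceTerm n B)
                                                                               ≈⟨ +-congʳ (sum-*ˡ (suc n) a (laplaceTerm n A)) ⟩
      a * sumF K (suc n) (laplaceTerm n A) + sumF K (suc n) (laplaceTerm n B)  ≈⟨ +-cong (*-congˡ (det-laplace n A)) (det-laplace n B) ⟨
      a * det K (suc n) A + det K (suc n) B                                    ∎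
    where
    termwise : ∀ j → laplaceTerm n C j ≈ a * laplaceTerm n A j + laplaceTerm n B j
    termwise j with j Fin.≟ k
    ... | yes ≡.refl = begin
        σ * (C Fin.zero j * dC)                            ≈⟨ *-congˡ (*-cong (hC Fin.zero) (sym dA≈dC)) ⟩
        σ * ((a * A Fin.zero j + B Fin.zero j) * dA)       ≈⟨ solve 5 (λ s a x y d → s :* ((a :* x :+ y) :* d)
                                                                := a :* (s :* (x :* d)) :+ s :* (y :* d)) refl _ _ _ _ _ ⟩
        a * (σ * (A Fin.zero j * dA)) + σ * (B Fin.zero j * dA) ≈⟨ +-congˡ (*-congˡ (*-congˡ (trans dA≈dC (sym dB≈dC)))) ⟩
        a * (σ * (A Fin.zero j * dA)) + σ * (B Fin.zero j * dB) ∎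
      where
      σ  = alternating (toℕ j)
      dA = det K n (minor A j)
      dB = det K n (minor B j)
      dC = det K n (minor C j)
      dA≈dC : dA ≈ dC
      dA≈dC = det-cong n (λ r s → hA (Fin.suc r) (punchIn j s) (Fin.punchInᵢ≢i j s))
      dB≈dC : dB ≈ dC
      dB≈dC = det-cong n (λ r s → hB (Fin.suc r) (punchIn j s) (Fin.punchInᵢ≢i j s))
    ... | no j≢k = begin
        σ * (C Fin.zero j * dC)                            ≈⟨ *-congˡ (*-congˡ minor-linear) ⟩
        σ * (C Fin.zero j * (a * dA + dB))                 ≈⟨ solve 5 (λ s e a x y → s :* (e :* (a :* x :+ y))
                                                                := a :* (s :* (e :* x)) :+ s :* (e :* y)) refl _ _ _ _ _ ⟩
        a * (σ * (C Fin.zero j * dA)) + σ * (C Fin.zero j * dB)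
            ≈⟨ +-cong (*-congˡ (*-congˡ (*-congʳ (hA Fin.zero j j≢k)))) (*-congˡ (*-congʳ (hB Fin.zero j j≢k))) ⟨
        a * (σ * (A Fin.zero j * dA)) + σ * (B Fin.zero j * dB) ∎
      where
      σ  = alternating (toℕ j)
      dA = det K n (minor A j)
      dB = det K n (minor B j)
      dC = det K n (minor C j)
      k′ = punchOut j≢k
      punchIn-k′ : punchIn j k′ ≡ k
      punchIn-k′ = Fin.punchIn-punchOut j≢k
      off-k′ : ∀ s → ¬ s ≡ k′ → ¬ punchIn j s ≡ k
      off-k′ s s≢k′ eq = s≢k′ (Fin.punchIn-injective j s k′ (≡.trans eq (≡.sym punchIn-k′)))
      minor-linear : dC ≈ a * dA + dB
      minor-linear = det-linear n (minor A j) (minor B j) (minor C j) k′ a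
        (λ r s s≢k′ → hA (Fin.suc r) (punchIn j s) (off-k′ s s≢k′))
        (λ r s s≢k′ → hB (Fin.suc r) (punchIn j s) (off-k′ s s≢k′))
        (λ r → ≡.subst (λ t → C (Fin.suc r) t ≈ a * A (Fin.suc r) t + B (Fin.suc r) t)
                       (≡.sym punchIn-k′) (hC (Fin.suc r)))

  det-additive : ∀ n (A B C : Mat n) k →
    (∀ r s → ¬ s ≡ k → A r s ≈ C r s) → (∀ r s → ¬ s ≡ k → B r s ≈ C r s) →
    (∀ r → C r k ≈ A r k + B r k) → det K n C ≈ det K n A + det K n B
  det-additive n A B C k hA hB hC =
    trans (det-linear n A B C k 1# hA hB (λ r → trans (hC r) (+-congʳ (sym (*-identityˡ _)))))
          (+-congʳ (*-identityˡ _))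

  adjacent⇒≢ : ∀ {n} (a b : Fin n) → toℕ b ≡ suc (toℕ a) → ¬ a ≡ b
  adjacent⇒≢ a .a eq ≡.refl = ℕ.1+n≢n (≡.sym eq)

  punchOut-adjacent : ∀ {n} (l a b : Fin (suc n)) (l≢a : ¬ l ≡ a) (l≢b : ¬ l ≡ b) →
    toℕ b ≡ suc (toℕ a) → toℕ (punchOut l≢b) ≡ suc (toℕ (punchOut l≢a))
  punchOut-adjacent Fin.zero Fin.zero b l≢a l≢b eq = ⊥-elim (l≢a ≡.refl)
  punchOut-adjacent Fin.zero (Fin.suc a) (Fin.suc b) l≢a l≢b eq = ℕ.suc-injective eq
  punchOut-adjacent {suc n} (Fin.suc Fin.zero) Fin.zero (Fin.suc Fin.zero) l≢a l≢b eq = ⊥-elim (l≢b ≡.refl)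
  punchOut-adjacent {suc (suc n)} (Fin.suc (Fin.suc l)) Fin.zero (Fin.suc Fin.zero) l≢a l≢b eq = ≡.refl
  punchOut-adjacent {suc n} (Fin.suc l) Fin.zero (Fin.suc (Fin.suc b)) l≢a l≢b ()
  punchOut-adjacent {suc n} (Fin.suc l) (Fin.suc a) (Fin.suc b) l≢a l≢b eq =
    ≡.cong suc (punchOut-adjacent l a b (λ q → l≢a (≡.cong Fin.suc q)) (λ q → l≢b (≡.cong Fin.suc q)) (ℕ.suc-injective eq))

  punchIn-adjacent : ∀ {n} (a b : Fin (suc n)) (s : Fin n) → toℕ b ≡ suc (toℕ a) →
    punchIn a s ≡ punchIn b s ⊎ (punchIn a s ≡ b × punchIn b s ≡ a)
  punchIn-adjacent Fin.zero (Fin.suc Fin.zero) Fin.zero    eq = inj₂ (≡.refl , ≡.refl)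
  punchIn-adjacent Fin.zero (Fin.suc Fin.zero) (Fin.suc s) eq = inj₁ ≡.refl
  punchIn-adjacent Fin.zero (Fin.suc (Fin.suc b)) s ()
  punchIn-adjacent (Fin.suc a) (Fin.suc b) Fin.zero eq = inj₁ ≡.refl
  punchIn-adjacent (Fin.suc a) (Fin.suc b) (Fin.suc s) eq with punchIn-adjacent a b s (ℕ.suc-injective eq)
  ... | inj₁ q         = inj₁ (≡.cong Fin.suc q)
  ... | inj₂ (q₁ , q₂) = inj₂ (≡.cong Fin.suc q₁ , ≡.cong Fin.suc q₂)

  -- With equal adjacent columns a, b the minors along a and along b coincide,
  -- while their Laplace signs are opposite.
  det-adjacent-equal-cols : ∀ n (M : Mat n) a b → toℕ b ≡ suc (toℕ a) →
    (∀ r → M r a ≈ M r b) → det K n M ≈ 0#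
  det-adjacent-equal-cols (suc n) M a b adj h = begin
      det K (suc n) M                                 ≈⟨ det-laplace n M ⟩
      sumF K (suc n) (laplaceTerm n M)                ≈⟨ sum-pair (suc n) (laplaceTerm n M) a b (adjacent⇒≢ a b adj) others ⟩
      laplaceTerm n M a + laplaceTerm n M b           ≈⟨ +-congˡ (*-cong (reflexive (≡.cong alternating adj))
                                                                        (*-cong (sym (h Fin.zero)) (sym minors-equal))) ⟩
      σ * t + (- σ) * t                               ≈⟨ distribʳ t σ (- σ) ⟨
      (σ - σ) * t                                     ≈⟨ *-congʳ (-‿inverseʳ σ) ⟩
      0# * t                                          ≈⟨ zeroˡ t ⟩
      0#                                              ∎
    where
    σ = alternating (toℕ a)
    t = M Fin.zero a * det K n (minor M a)
    minors-equal : det K n (minor M a) ≈ det K n (minor M b)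
    minors-equal = det-cong n entry
      where
      entry : ∀ r s → minor M a r s ≈ minor M b r s
      entry r s with punchIn-adjacent a b s adj
      ... | inj₁ q         = reflexive (≡.cong (M (Fin.suc r)) q)
      ... | inj₂ (q₁ , q₂) = trans (reflexive (≡.cong (M (Fin.suc r)) q₁))
                               (trans (sym (h (Fin.suc r))) (reflexive (≡.cong (M (Fin.suc r)) (≡.sym q₂))))
    others : ∀ j → ¬ j ≡ a → ¬ j ≡ b → laplaceTerm n M j ≈ 0#
    others j j≢a j≢b = trans (*-congˡ (*-congˡ minor-zero)) (trans (*-congˡ (zeroʳ _)) (zeroʳ _))
      where
      minor-zero : det K n (minor M j) ≈ 0#
      minor-zero = det-adjacent-equal-cols n (minor M j) (punchOut j≢a) (punchOut j≢b)
        (punchOut-adjacent j a b j≢a j≢b adj)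
        (λ r → trans (reflexive (≡.cong (M (Fin.suc r)) (Fin.punchIn-punchOut j≢a)))
               (trans (h (Fin.suc r)) (reflexive (≡.cong (M (Fin.suc r)) (≡.sym (Fin.punchIn-punchOut j≢b))))))

  setCol : ∀ {n} → Mat n → Fin n → (Fin n → Carrier) → Mat n
  setCol M k u r s with s Fin.≟ k
  ... | yes _ = u r
  ... | no  _ = M r s

  setCol-agree : ∀ {n} (M N : Mat n) k u v r s → (¬ s ≡ k → M r s ≈ N r s) → (s ≡ k → u r ≈ v r) →
    setCol M k u r s ≈ setCol N k v r s
  setCol-agree M N k u v r s off on with s Fin.≟ k
  ... | yes s≡k = on s≡k
  ... | no  s≢k = off s≢k

  setCol-≡ : ∀ {n} (M : Mat n) k u r → setCol M k u r k ≈ u r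
  setCol-≡ M k u r with k Fin.≟ k
  ... | yes _   = refl
  ... | no  k≢k = ⊥-elim (k≢k ≡.refl)

  setCol-≢ : ∀ {n} (M : Mat n) k u r s → ¬ s ≡ k → setCol M k u r s ≈ M r s
  setCol-≢ M k u r s s≢k with s Fin.≟ k
  ... | yes s≡k = ⊥-elim (s≢k s≡k)
  ... | no  _   = refl

  setCol-self : ∀ {n} (M : Mat n) k r s → setCol M k (λ r → M r k) r s ≈ M r s
  setCol-self M k r s with s Fin.≟ k
  ... | yes ≡.refl = refl
  ... | no  _      = refl

  -- Put the column sum p + q in both columns a and b: that determinant vanishes,
  -- and expanding it bilinearly leaves det A + det B.
  det-swap-adjacent-cols : ∀ n (A B : Mat n) a b → toℕ b ≡ suc (toℕ a) →
    (∀ r → B r a ≈ A r b) → (∀ r → B r b ≈ A r a) → (∀ r s → ¬ s ≡ a → ¬ s ≡ b → B r s ≈ A r s) →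
    det K n B ≈ - det K n A
  det-swap-adjacent-cols n A B a b adj hBa hBb hBo = +-inverseˡ-unique _ _ (trans (+-comm _ _) det-A+det-B≈0)
    where
    open import Algebra.Properties.Ring ring using (+-inverseˡ-unique)
    a≢b = adjacent⇒≢ a b adj
    p q : Fin n → Carrier
    p r = A r a
    q r = A r b
    X : (Fin n → Carrier) → (Fin n → Carrier) → Mat n
    X u v = setCol (setCol A a u) b v
    d : (Fin n → Carrier) → (Fin n → Carrier) → Carrier
    d u v = det K n (X u v)
    X-a : ∀ u v r → X u v r a ≈ u r
    X-a u v r = trans (setCol-≢ _ b v r a a≢b) (setCol-≡ A a u r)
    X-b : ∀ u v r → X u v r b ≈ v r
    X-b u v r = setCol-≡ _ b v r
    d-diagonal : ∀ u → d u u ≈ 0#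
    d-diagonal u = det-adjacent-equal-cols n (X u u) a b adj (λ r → trans (X-a u u r) (sym (X-b u u r)))
    d-additiveˡ : ∀ u₁ u₂ v → d (λ r → u₁ r + u₂ r) v ≈ d u₁ v + d u₂ v
    d-additiveˡ u₁ u₂ v = det-additive n (X u₁ v) (X u₂ v) (X (λ r → u₁ r + u₂ r) v) a
      (λ r s s≢a → off-a u₁ r s s≢a) (λ r s s≢a → off-a u₂ r s s≢a)
      (λ r → trans (X-a _ v r) (sym (+-cong (X-a u₁ v r) (X-a u₂ v r))))
      where
      off-a : ∀ u r s → ¬ s ≡ a → X u v r s ≈ X (λ r → u₁ r + u₂ r) v r s
      off-a u r s s≢a = setCol-agree _ _ b v v r s
        (λ _ → setCol-agree A A a _ _ r s (λ _ → refl) (λ s≡a → ⊥-elim (s≢a s≡a))) (λ _ → refl)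
    d-additiveʳ : ∀ u v₁ v₂ → d u (λ r → v₁ r + v₂ r) ≈ d u v₁ + d u v₂
    d-additiveʳ u v₁ v₂ = det-additive n (X u v₁) (X u v₂) (X u (λ r → v₁ r + v₂ r)) b
      (λ r s s≢b → off-b v₁ r s s≢b) (λ r s s≢b → off-b v₂ r s s≢b)
      (λ r → trans (X-b u _ r) (sym (+-cong (X-b u v₁ r) (X-b u v₂ r))))
      where
      off-b : ∀ v r s → ¬ s ≡ b → X u v r s ≈ X u (λ r → v₁ r + v₂ r) r s
      off-b v r s s≢b = setCol-agree _ _ b _ _ r s (λ _ → refl) (λ s≡b → ⊥-elim (s≢b s≡b))
    d-A : d p q ≈ det K n A
    d-A = det-cong n (λ r s → trans (setCol-agree _ A b q q r s (λ _ → setCol-self A a r s) (λ _ → refl))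
                                      (setCol-self A b r s))
    d-B : d q p ≈ det K n B
    d-B = det-cong n entry
      where
      entry : ∀ r s → X q p r s ≈ B r s
      entry r s = by-column (s Fin.≟ a) (s Fin.≟ b)
        where
        by-column : Dec (s ≡ a) → Dec (s ≡ b) → X q p r s ≈ B r s
        by-column (yes s≡a) _         = ≡.subst (λ t → X q p r t ≈ B r t) (≡.sym s≡a) (trans (X-a q p r) (sym (hBa r)))
        by-column (no _)    (yes s≡b) = ≡.subst (λ t → X q p r t ≈ B r t) (≡.sym s≡b) (trans (X-b q p r) (sym (hBb r)))
        by-column (no s≢a)  (no s≢b)  = trans (setCol-≢ _ b p r s s≢b)
                                          (trans (setCol-≢ A a q r s s≢a) (sym (hBo r s s≢a s≢b)))
    det-A+det-B≈0 : det K n A + det K n B ≈ 0#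
    det-A+det-B≈0 = begin
      det K n A + det K n B                  ≈⟨ +-cong d-A d-B ⟨
      d p q + d q p                          ≈⟨ +-cong (+-identityˡ _) (+-identityʳ _) ⟨
      (0# + d p q) + (d q p + 0#)            ≈⟨ +-cong (+-congʳ (d-diagonal p)) (+-congˡ (d-diagonal q)) ⟨
      (d p p + d p q) + (d q p + d q q)      ≈⟨ +-cong (d-additiveʳ p p q) (d-additiveʳ q p q) ⟨
      d p (λ r → p r + q r) + d q (λ r → p r + q r) ≈⟨ d-additiveˡ p q _ ⟨
      d (λ r → p r + q r) (λ r → p r + q r)  ≈⟨ d-diagonal _ ⟩
      0#                                     ∎

  private
    det-equal-cols-at-distance : ∀ δ n (M : Mat n) a b → toℕ b ≡ suc (δ ℕ.+ toℕ a) →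
      (∀ r → M r a ≈ M r b) → det K n M ≈ 0#
    det-equal-cols-at-distance zero      n       M a b           eq h = det-adjacent-equal-cols n M a b eq h
    det-equal-cols-at-distance (suc δ)   (suc n) M a (Fin.suc x) eq h = begin
        det K (suc n) M          ≈⟨ -‿involutive _ ⟨
        - (- det K (suc n) M)    ≈⟨ -‿cong swapped ⟨
        - det K (suc n) B        ≈⟨ -‿cong closer ⟩
        - 0#                     ≈⟨ -0#≈0# ⟩
        0#                       ∎
      where
      b  = Fin.suc x
      b′ = inject₁ x
      b′-distance : toℕ b′ ≡ suc (δ ℕ.+ toℕ a)
      b′-distance = ≡.trans (Fin.toℕ-inject₁ x) (ℕ.suc-injective eq)
      b′-adjacent : toℕ b ≡ suc (toℕ b′)
      b′-adjacent = ≡.cong suc (≡.sym (Fin.toℕ-inject₁ x))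
      a<b′ : toℕ a ℕ.< toℕ b′
      a<b′ = ℕ.≤-trans (ℕ.s≤s (ℕ.m≤n+m (toℕ a) δ)) (ℕ.≤-reflexive (≡.sym b′-distance))
      a≢b′ : ¬ a ≡ b′
      a≢b′ a≡b′ = ℕ.<-irrefl (≡.cong toℕ a≡b′) a<b′
      a≢b : ¬ a ≡ b
      a≢b a≡b = ℕ.<-irrefl (≡.cong toℕ a≡b) (ℕ.<-trans a<b′ (ℕ.≤-reflexive (≡.sym b′-adjacent)))
      B : Mat (suc n)
      B = setCol (setCol M b′ (λ r → M r b)) b (λ r → M r b′)
      swapped : det K (suc n) B ≈ - det K (suc n) M
      swapped = det-swap-adjacent-cols (suc n) M B b′ b b′-adjacent
        (λ r → trans (setCol-≢ _ b _ r b′ (adjacent⇒≢ b′ b b′-adjacent)) (setCol-≡ M b′ _ r))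
        (λ r → setCol-≡ _ b _ r)
        (λ r s s≢b′ s≢b → trans (setCol-≢ _ b _ r s s≢b) (setCol-≢ M b′ _ r s s≢b′))
      closer : det K (suc n) B ≈ 0#
      closer = det-equal-cols-at-distance δ (suc n) B a b′ b′-distance (λ r → begin
        B r a   ≈⟨ setCol-≢ _ b _ r a a≢b ⟩
        setCol M b′ (λ r → M r b) r a ≈⟨ setCol-≢ M b′ _ r a a≢b′ ⟩
        M r a   ≈⟨ h r ⟩
        M r b   ≈⟨ setCol-≡ M b′ _ r ⟨
        setCol M b′ (λ r → M r b) r b′ ≈⟨ setCol-≢ _ b _ r b′ (adjacent⇒≢ b′ b b′-adjacent) ⟨
        B r b′  ∎)

  det-equal-cols : ∀ n (M : Mat n) j k → ¬ j ≡ k → (∀ r → M r j ≈ M r k) → det K n M ≈ 0#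
  det-equal-cols n M j k j≢k h with ℕ.<-cmp (toℕ j) (toℕ k)
  ... | tri< j<k _ _ = det-equal-cols-at-distance (toℕ k ∸ suc (toℕ j)) n M j k
                         (≡.trans (≡.sym (ℕ.m∸n+n≡m j<k)) (ℕ.+-suc _ _)) h
  ... | tri≈ _ j≡k _ = ⊥-elim (j≢k (Fin.toℕ-injective j≡k))
  ... | tri> _ _ k<j = det-equal-cols-at-distance (toℕ j ∸ suc (toℕ k)) n M k j
                         (≡.trans (≡.sym (ℕ.m∸n+n≡m k<j)) (ℕ.+-suc _ _)) (λ r → sym (h r))

  det-setCol-sum : ∀ n (M : Mat n) k m (v : Fin m → Carrier) (w : Fin m → Fin n → Carrier) →
    det K n (setCol M k (λ r → sumF K m (λ j → v j * w j r))) ≈ sumF K m (λ j → v j * det K n (setCol M k (w j)))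
  det-setCol-sum n M k zero v w = x+x≈x⇒x≈0 _ (sym (det-additive n C C C k (λ _ _ _ → refl) (λ _ _ _ → refl)
      (λ r → trans (setCol-≡ M k _ r) (sym (trans (+-cong (setCol-≡ M k _ r) (setCol-≡ M k _ r)) (+-identityˡ 0#))))))
    where C = setCol M k (λ r → 0#)
  det-setCol-sum n M k (suc m) v w = begin
      det K n (setCol M k (λ r → sumF K (suc m) (λ j → v j * w j r)))
        ≈⟨ det-linear n (setCol M k (w Fin.zero)) (setCol M k rest) _ k (v Fin.zero) same same
             (λ r → trans (setCol-≡ M k _ r) (sym (+-cong (*-congˡ (setCol-≡ M k _ r)) (setCol-≡ M k _ r)))) ⟩
      v Fin.zero * det K n (setCol M k (w Fin.zero)) + det K n (setCol M k rest)
        ≈⟨ +-congˡ (det-setCol-sum n M k m (λ j → v (Fin.suc j)) (λ j → w (Fin.suc j))) ⟩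
      v Fin.zero * det K n (setCol M k (w Fin.zero)) + sumF K m (λ j → v (Fin.suc j) * det K n (setCol M k (w (Fin.suc j))))
        ∎
    where
    rest : Fin n → Carrier
    rest r = sumF K m (λ j → v (Fin.suc j) * w (Fin.suc j) r)
    same : ∀ {u u′} r s → ¬ s ≡ k → setCol M k u r s ≈ setCol M k u′ r s
    same r s s≢k = trans (setCol-≢ M k _ r s s≢k) (sym (setCol-≢ M k _ r s s≢k))

  det-setCol-combination : ∀ n (M : Mat n) k (v : Fin n → Carrier) →
    det K n (setCol M k (λ r → sumF K n (λ j → v j * M r j))) ≈ v k * det K n M
  det-setCol-combination n M k v = begin
      det K n (setCol M k (λ r → sumF K n (λ j → v j * M r j)))   ≈⟨ det-setCol-sum n M k n v (λ j r → M r j) ⟩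
      sumF K n (λ j → v j * det K n (setCol M k (λ r → M r j)))   ≈⟨ sum-single n _ k others ⟩
      v k * det K n (setCol M k (λ r → M r k))                    ≈⟨ *-congˡ (det-cong n (setCol-self M k)) ⟩
      v k * det K n M                                             ∎
    where
    others : ∀ j → ¬ j ≡ k → v j * det K n (setCol M k (λ r → M r j)) ≈ 0#
    others j j≢k = trans (*-congˡ (det-equal-cols n _ j k j≢k
      (λ r → trans (setCol-≢ M k _ r j j≢k) (sym (setCol-≡ M k _ r))))) (zeroʳ _)

module DeterminantValuation {c ℓ} (K : NumberField c ℓ) (𝔭 : FinitePlace K) where
  open NumberField K
  open FinitePlace 𝔭
  open ℤ∞-Properties
  open Valuation K 𝔭
  open Determinant K

  integral-alternating : ∀ k → Integral K 𝔭 (alternating k)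
  integral-alternating zero    = integral-1#
  integral-alternating (suc k) = ≤ν-neg (integral-alternating k)

  det-integral : ∀ n (M : Mat n) → (∀ r s → Integral K 𝔭 (M r s)) → Integral K 𝔭 (det K n M)
  det-integral zero    M h = integral-1#
  det-integral (suc n) M h = ≤ν-resp-≈ (sym (det-laplace n M)) (≤ν-sum (suc n) (laplaceTerm n M) (λ j →
      ≤ν-*ˡ (integral-alternating (toℕ j)) (≤ν-*ˡ (h _ _) (det-integral n (minor M j) (λ r s → h _ _)))))

  det-≤ν-col : ∀ {e} n (M : Mat n) k → (∀ r s → Integral K 𝔭 (M r s)) → (∀ r → e ≤∞ ν (M r k)) →
    e ≤∞ ν (det K n M)
  det-≤ν-col (suc n) M k h hk = ≤ν-resp-≈ (sym (det-laplace n M)) (≤ν-sum (suc n) (laplaceTerm n M) term)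
    where
    term : ∀ j → _ ≤∞ ν (laplaceTerm n M j)
    term j with j Fin.≟ k
    ... | yes ≡.refl = ≤ν-*ˡ (integral-alternating (toℕ j))
                         (≤ν-*ʳ (hk Fin.zero) (det-integral n (minor M j) (λ r s → h _ _)))
    ... | no j≢k     = ≤ν-*ˡ (integral-alternating (toℕ j)) (≤ν-*ˡ (h _ _)
                         (det-≤ν-col n (minor M j) (punchOut j≢k) (λ r s → h _ _)
                           (λ r → ≡.subst (λ t → _ ≤∞ ν (M (Fin.suc r) t))
                                          (≡.sym (Fin.punchIn-punchOut j≢k)) (hk (Fin.suc r)))))

  -- By Cramer's rule v k · det M is the determinant of a matrix whose column k
  -- is M v; dividing by the unit v k costs nothing.
  det-≤ν-of-unit-combination : ∀ {e} n (M : Mat n) (v : Fin n → Carrier) k →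
    (∀ r s → Integral K 𝔭 (M r s)) → (∀ j → Integral K 𝔭 (v j)) → ν (v k) ≡ fin (+ 0) →
    (∀ r → e ≤∞ ν (sumF K n (λ j → v j * M r j))) → e ≤∞ ν (det K n M)
  det-≤ν-of-unit-combination {e} n M v k hM hv vk-unit hMv =
    ≤∞-trans v-k-det (≤∞-reflexive (≡.trans (ν-* (v k) (det K n M))
      (≡.trans (≡.cong (_+∞ ν (det K n M)) vk-unit) (+∞-identityˡ _))))
    where
    N = setCol M k (λ r → sumF K n (λ j → v j * M r j))
    N-integral : ∀ r s → Integral K 𝔭 (N r s)
    N-integral r s = setCol-integral (s Fin.≟ k)
      where
      setCol-integral : Dec (s ≡ k) → Integral K 𝔭 (N r s)
      setCol-integral (yes s≡k) = ≤ν-resp-≈ (sym (≡.subst (λ t → N r t ≈ _) (≡.sym s≡k) (setCol-≡ M k _ r)))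
                                    (≤ν-sum n _ (λ j → ≤ν-*ˡ (hv j) (hM r j)))
      setCol-integral (no s≢k)  = ≤ν-resp-≈ (sym (setCol-≢ M k _ r s s≢k)) (hM r s)
    v-k-det : e ≤∞ ν (v k * det K n M)
    v-k-det = ≤ν-resp-≈ (det-setCol-combination n M k v)
      (det-≤ν-col n N k N-integral (λ r → ≤ν-resp-≈ (sym (setCol-≡ M k _ r)) (hMv r)))

module Forms {c ℓ} (K : NumberField c ℓ) where
  open NumberField K
  open Solver K
  open Determinant K using (sum-cong; sum-*ˡ)
  open import Relation.Binary.Reasoning.Setoid setoid

  pow-cong : ∀ {x x′} n → x ≈ x′ → pow K x n ≈ pow K x′ n
  pow-cong zero    _   = refl
  pow-cong (suc n) x≈x′ = *-cong x≈x′ (pow-cong n x≈x′)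

  pow-+ : ∀ x m n → pow K x (m ℕ.+ n) ≈ pow K x m * pow K x n
  pow-+ x zero    n = sym (*-identityˡ _)
  pow-+ x (suc m) n = trans (*-congˡ (pow-+ x m n)) (sym (*-assoc _ _ _))

  pow-* : ∀ a x n → pow K (a * x) n ≈ pow K a n * pow K x n
  pow-* a x zero    = sym (*-identityˡ 1#)
  pow-* a x (suc n) = trans (*-congˡ (pow-* a x n))
    (solve 4 (λ a x p q → (a :* x) :* (p :* q) := (a :* p) :* (x :* q)) refl _ _ _ _)

  monomialTerm : ∀ {D} → Form K D → Carrier → Carrier → Fin (suc D) → Carrier
  monomialTerm {D} f x y k = f k * (pow K x (D ∸ toℕ k) * pow K y (toℕ k))

  evalForm-cong : ∀ {D} (f : Form K D) {x x′ y y′} → x ≈ x′ → y ≈ y′ → evalForm K f x y ≈ evalForm K f x′ y′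
  evalForm-cong {D} f {x} {x′} {y} {y′} x≈x′ y≈y′ = sum-cong (suc D)
    {f = monomialTerm f x y} {g = monomialTerm f x′ y′}
    (λ k → *-congˡ (*-cong (pow-cong (D ∸ toℕ k) x≈x′) (pow-cong (toℕ k) y≈y′)))

  evalForm-scale : ∀ {D} (f : Form K D) s x y → evalForm K (λ k → s * f k) x y ≈ s * evalForm K f x y
  evalForm-scale {D} f s x y = trans
    (sum-cong (suc D) {f = monomialTerm (λ k → s * f k) x y} {g = λ k → s * monomialTerm f x y k}
              (λ k → *-assoc _ _ _))
    (sum-*ˡ (suc D) s (monomialTerm f x y))

  evalForm-homogeneous : ∀ {D} (f : Form K D) a x y →
    evalForm K f (a * x) (a * y) ≈ pow K a D * evalForm K f x y
  evalForm-homogeneous {D} f a x y = trans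
    (sum-cong (suc D) {f = monomialTerm f (a * x) (a * y)} {g = λ k → pow K a D * monomialTerm f x y k} term)
    (sum-*ˡ (suc D) (pow K a D) (monomialTerm f x y))
    where
    term : ∀ k → monomialTerm f (a * x) (a * y) k ≈ pow K a D * monomialTerm f x y k
    term k = begin
      f k * (pow K (a * x) (D ∸ i) * pow K (a * y) i)
        ≈⟨ *-congˡ (*-cong (pow-* a x (D ∸ i)) (pow-* a y i)) ⟩
      f k * ((pow K a (D ∸ i) * pow K x (D ∸ i)) * (pow K a i * pow K y i))
        ≈⟨ solve 5 (λ f p q r s → f :* ((p :* q) :* (r :* s)) := (p :* r) :* (f :* (q :* s))) refl _ _ _ _ _ ⟩
      (pow K a (D ∸ i) * pow K a i) * (f k * (pow K x (D ∸ i) * pow K y i))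
        ≈⟨ *-congʳ (trans (sym (pow-+ a (D ∸ i) i)) (reflexive (≡.cong (pow K a) (ℕ.m∸n+n≡m (ℕ.≤-pred (Fin.toℕ<n k)))))) ⟩
      pow K a D * (f k * (pow K x (D ∸ i) * pow K y i)) ∎
      where i = toℕ k

module Sylvester {c ℓ} (K : NumberField c ℓ) where
  open NumberField K
  open Solver K
  open Forms K using (pow-+)
  open Determinant K using (sum-cong)
  open import Relation.Binary.Reasoning.Setoid setoid

  shifted : ∀ {D} → Form K D → ℕ → ℕ → Carrier
  shifted f r t with r ℕ.≤? t
  ... | yes _ = coef K f (t ∸ r)
  ... | no  _ = 0#

  sylvester-upper : ∀ {D} (a b : Form K D) (i j : Fin (D ℕ.+ D)) → toℕ i ℕ.< D →
    sylvester K a b i j ≡ shifted a (toℕ i) (toℕ j)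
  sylvester-upper {D} a b i j i<D with toℕ i ℕ.<? D
  ... | no i≮D = ⊥-elim (i≮D i<D)
  ... | yes _ with toℕ i ℕ.≤? toℕ j
  ...   | yes _ = ≡.refl
  ...   | no  _ = ≡.refl

  sylvester-lower : ∀ {D} (a b : Form K D) (i j : Fin (D ℕ.+ D)) → ¬ toℕ i ℕ.< D →
    sylvester K a b i j ≡ shifted b (toℕ i ∸ D) (toℕ j)
  sylvester-lower {D} a b i j i≮D with toℕ i ℕ.<? D
  ... | yes i<D = ⊥-elim (i≮D i<D)
  ... | no _ with toℕ i ∸ D ℕ.≤? toℕ j
  ...   | yes _ = ≡.refl
  ...   | no  _ = ≡.refl

  sumℕ : ℕ → (ℕ → Carrier) → Carrier
  sumℕ zero    f = 0#
  sumℕ (suc n) f = f 0 + sumℕ n (λ t → f (suc t))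

  sumF-toℕ : ∀ n (f : ℕ → Carrier) → sumF K n (λ j → f (toℕ j)) ≡ sumℕ n f
  sumF-toℕ zero    f = ≡.refl
  sumF-toℕ (suc n) f = ≡.cong (λ s → f 0 + s) (sumF-toℕ n (λ t → f (suc t)))

  sumℕ-cong : ∀ n (f g : ℕ → Carrier) → (∀ t → t ℕ.< n → f t ≈ g t) → sumℕ n f ≈ sumℕ n g
  sumℕ-cong zero    f g h = refl
  sumℕ-cong (suc n) f g h = +-cong (h 0 ℕ.z<s) (sumℕ-cong n _ _ (λ t t<n → h (suc t) (ℕ.s<s t<n)))

  sumℕ-zero : ∀ n (f : ℕ → Carrier) → (∀ t → t ℕ.< n → f t ≈ 0#) → sumℕ n f ≈ 0#
  sumℕ-zero n f h = trans (sumℕ-cong n f (λ _ → 0#) h) (zeros n)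
    where
    zeros : ∀ n → sumℕ n (λ _ → 0#) ≈ 0#
    zeros zero    = refl
    zeros (suc n) = trans (+-identityˡ _) (zeros n)

  sumℕ-+ : ∀ m n (f : ℕ → Carrier) → sumℕ (m ℕ.+ n) f ≈ sumℕ m f + sumℕ n (λ t → f (m ℕ.+ t))
  sumℕ-+ zero    n f = sym (+-identityˡ _)
  sumℕ-+ (suc m) n f = trans (+-congˡ (sumℕ-+ m n (λ t → f (suc t)))) (sym (+-assoc _ _ _))

  sumℕ-*ˡ : ∀ n a (f : ℕ → Carrier) → sumℕ n (λ t → a * f t) ≈ a * sumℕ n f
  sumℕ-*ˡ zero    a f = sym (zeroʳ a)
  sumℕ-*ˡ (suc n) a f = trans (+-congˡ (sumℕ-*ˡ n a _)) (sym (distribˡ a _ _))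

  coef-toℕ : ∀ {D} (f : Form K D) (k : Fin (suc D)) → coef K f (toℕ k) ≡ f k
  coef-toℕ {D} f k with toℕ k ℕ.<? suc D
  ... | yes k<D = ≡.cong f (Fin.fromℕ<-toℕ k k<D)
  ... | no  k≮D = ⊥-elim (k≮D (Fin.toℕ<n k))

  coef-beyond : ∀ {D} (f : Form K D) t → coef K f (suc D ℕ.+ t) ≡ 0#
  coef-beyond {D} f t with suc D ℕ.+ t ℕ.<? suc D
  ... | yes lt = ⊥-elim (ℕ.<-irrefl ≡.refl (ℕ.<-≤-trans lt (ℕ.m≤m+n (suc D) t)))
  ... | no  _  = ≡.refl

  shifted-below : ∀ {D} (f : Form K D) r t → t ℕ.< r → shifted f r t ≡ 0#
  shifted-below f r t t<r with r ℕ.≤? t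
  ... | yes r≤t = ⊥-elim (ℕ.<-irrefl ≡.refl (ℕ.<-≤-trans t<r r≤t))
  ... | no  _   = ≡.refl

  shifted-above : ∀ {D} (f : Form K D) r k → shifted f r (r ℕ.+ k) ≡ coef K f k
  shifted-above f r k with r ℕ.≤? (r ℕ.+ k)
  ... | yes _   = ≡.cong (coef K f) (ℕ.m+n∸m≡n r k)
  ... | no  r≰ = ⊥-elim (r≰ (ℕ.m≤m+n r k))

  evalForm-sumℕ : ∀ {D} (f : Form K D) x y →
    evalForm K f x y ≈ sumℕ (suc D) (λ k → coef K f k * (pow K x (D ∸ k) * pow K y k))
  evalForm-sumℕ {D} f x y = trans
    (sum-cong (suc D) {f = λ k → f k * (pow K x (D ∸ toℕ k) * pow K y (toℕ k))}
                      {g = λ k → coef K f (toℕ k) * (pow K x (D ∸ toℕ k) * pow K y (toℕ k))}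
                      (λ k → *-congʳ (reflexive (≡.sym (coef-toℕ f k)))))
    (reflexive (sumF-toℕ (suc D) (λ k → coef K f k * (pow K x (D ∸ k) * pow K y k))))

  monomial : ℕ → Carrier → Carrier → ℕ → Carrier
  monomial N x y t = pow K x (N ∸ suc t) * pow K y t

  -- A row of the Sylvester matrix holds the coefficients of X^(D-1-r) Y^r · f,
  -- so pairing it with all monomials of degree 2D - 1 evaluates that form.
  sylvesterRow-monomials : ∀ {D} (f : Form K D) r → r ℕ.< D → ∀ x y →
    sumℕ (D ℕ.+ D) (λ t → monomial (D ℕ.+ D) x y t * shifted f r t) ≈ monomial D x y r * evalForm K f x y
  sylvesterRow-monomials {D} f r r<D x y = begin
      sumℕ (D ℕ.+ D) g                                       ≡⟨ ≡.cong (λ n → sumℕ n g) size ⟩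
      sumℕ (r ℕ.+ (suc D ℕ.+ p)) g                           ≈⟨ sumℕ-+ r (suc D ℕ.+ p) g ⟩
      sumℕ r g + sumℕ (suc D ℕ.+ p) (λ t → g (r ℕ.+ t))      ≈⟨ +-cong (sumℕ-zero r g before) (sumℕ-+ (suc D) p (λ t → g (r ℕ.+ t))) ⟩
      0# + (sumℕ (suc D) (λ k → g (r ℕ.+ k)) + sumℕ p (λ t → g (r ℕ.+ (suc D ℕ.+ t))))
                                                             ≈⟨ trans (+-identityˡ _) (+-congˡ (sumℕ-zero p _ after)) ⟩
      sumℕ (suc D) (λ k → g (r ℕ.+ k)) + 0#                  ≈⟨ +-identityʳ _ ⟩
      sumℕ (suc D) (λ k → g (r ℕ.+ k))                       ≈⟨ sumℕ-cong (suc D) _ _ within ⟩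
      sumℕ (suc D) (λ k → X * (coef K f k * W k))            ≈⟨ sumℕ-*ˡ (suc D) X (λ k → coef K f k * W k) ⟩
      X * sumℕ (suc D) (λ k → coef K f k * W k)              ≈⟨ *-congˡ (evalForm-sumℕ f x y) ⟨
      X * evalForm K f x y                                   ∎
    where
    open ℕ-Solver.+-*-Solver using () renaming (solve to solveℕ; _:+_ to _ℕ:+_; _:=_ to _ℕ:=_; con to ℕcon)
    p = D ∸ suc r
    r+p : suc r ℕ.+ p ≡ D
    r+p = ℕ.m+[n∸m]≡n r<D
    size : D ℕ.+ D ≡ r ℕ.+ (suc D ℕ.+ p)
    size = ≡.trans (≡.cong (ℕ._+ D) (≡.sym r+p))
      (solveℕ 3 (λ r p D → (ℕcon 1 ℕ:+ r ℕ:+ p) ℕ:+ D ℕ:= r ℕ:+ (ℕcon 1 ℕ:+ D ℕ:+ p)) ≡.refl r p D)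
    g : ℕ → Carrier
    g t = monomial (D ℕ.+ D) x y t * shifted f r t
    X = monomial D x y r
    W : ℕ → Carrier
    W k = pow K x (D ∸ k) * pow K y k
    before : ∀ t → t ℕ.< r → g t ≈ 0#
    before t t<r = trans (*-congˡ (reflexive (shifted-below f r t t<r))) (zeroʳ _)
    after : ∀ t → t ℕ.< p → g (r ℕ.+ (suc D ℕ.+ t)) ≈ 0#
    after t _ = trans (*-congˡ (reflexive (≡.trans (shifted-above f r (suc D ℕ.+ t)) (coef-beyond f t)))) (zeroʳ _)
    within : ∀ k → k ℕ.< suc D → g (r ℕ.+ k) ≈ X * (coef K f k * W k)
    within k k≤D = begin
      monomial (D ℕ.+ D) x y (r ℕ.+ k) * shifted f r (r ℕ.+ k)
        ≈⟨ *-cong (*-congʳ (reflexive (≡.cong (pow K x) x-degree))) (reflexive (shifted-above f r k)) ⟩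
      (pow K x (p ℕ.+ (D ∸ k)) * pow K y (r ℕ.+ k)) * coef K f k
        ≈⟨ *-congʳ (*-cong (pow-+ x p _) (pow-+ y r k)) ⟩
      ((pow K x p * pow K x (D ∸ k)) * (pow K y r * pow K y k)) * coef K f k
        ≈⟨ solve 5 (λ a b c d e → ((a :* b) :* (c :* d)) :* e := (a :* c) :* (e :* (b :* d))) refl _ _ _ _ _ ⟩
      X * (coef K f k * W k) ∎
      where
      k+q : k ℕ.+ (D ∸ k) ≡ D
      k+q = ℕ.m+[n∸m]≡n (ℕ.≤-pred k≤D)
      x-degree : (D ℕ.+ D) ∸ suc (r ℕ.+ k) ≡ p ℕ.+ (D ∸ k)
      x-degree = ≡.trans (≡.cong (_∸ suc (r ℕ.+ k)) (≡.trans (≡.cong₂ ℕ._+_ (≡.sym r+p) (≡.sym k+q))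
          (solveℕ 4 (λ r p k q → (ℕcon 1 ℕ:+ r ℕ:+ p) ℕ:+ (k ℕ:+ q) ℕ:= (ℕcon 1 ℕ:+ (r ℕ:+ k)) ℕ:+ (p ℕ:+ q))
                 ≡.refl r p k (D ∸ k))))
        (ℕ.m+n∸m≡n (suc (r ℕ.+ k)) (p ℕ.+ (D ∸ k)))

module FormValuation {c ℓ} (K : NumberField c ℓ) (𝔭 : FinitePlace K) where
  open NumberField K
  open FinitePlace 𝔭
  open Solver K
  open ℤ∞-Properties
  open Valuation K 𝔭
  open Determinant K using (Mat; sum-cong)
  open DeterminantValuation K 𝔭 using (det-≤ν-of-unit-combination)
  open Forms K
  open Sylvester K
  open import Relation.Binary.Reasoning.Setoid setoid

  IntegralForm : ∀ {D} → Form K D → Set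
  IntegralForm f = ∀ k → Integral K 𝔭 (f k)

  coef-integral : ∀ {D} (f : Form K D) → IntegralForm f → ∀ t → Integral K 𝔭 (coef K f t)
  coef-integral {D} f h t with t ℕ.<? suc D
  ... | yes _ = h _
  ... | no  _ = ≤ν-0#

  shifted-integral : ∀ {D} (f : Form K D) → IntegralForm f → ∀ r t → Integral K 𝔭 (shifted f r t)
  shifted-integral f h r t with r ℕ.≤? t
  ... | yes _ = coef-integral f h (t ∸ r)
  ... | no  _ = ≤ν-0#

  evalForm-integral : ∀ {D} (f : Form K D) → IntegralForm f → ∀ {x y} →
    Integral K 𝔭 x → Integral K 𝔭 y → Integral K 𝔭 (evalForm K f x y)
  evalForm-integral {D} f h {x} {y} x-int y-int = ≤ν-sum (suc D) (monomialTerm f x y)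
    (λ k → ≤ν-*ˡ (h k) (≤ν-*ˡ (integral-pow (D ∸ toℕ k) x-int) (integral-pow (toℕ k) y-int)))

  Normalized : Carrier → Carrier → Set
  Normalized x y = min∞ (ν x) (ν y) ≡ fin (+ 0)

  normalized-integral : ∀ {x y} → Normalized x y → Integral K 𝔭 x × Integral K 𝔭 y
  normalized-integral {x} {y} eq = ≤∞-trans (≤∞-reflexive (≡.sym eq)) (min∞-≤ˡ (ν x) (ν y))
                                 , ≤∞-trans (≤∞-reflexive (≡.sym eq)) (min∞-≤ʳ (ν x) (ν y))

  normalized-unit : ∀ {x y} → Normalized x y → ν x ≡ fin (+ 0) ⊎ ν y ≡ fin (+ 0)
  normalized-unit {x} {y} eq with ν x | ν y
  ... | fin a | fin b with ℤ.⊓-sel a b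
  ...   | inj₁ a⊓b≡a = inj₁ (≡.cong fin (≡.trans (≡.sym a⊓b≡a) (fin-injective eq)))
  ...   | inj₂ a⊓b≡b = inj₂ (≡.cong fin (≡.trans (≡.sym a⊓b≡b) (fin-injective eq)))
  normalized-unit eq | fin a | ∞     = inj₁ eq
  normalized-unit eq | ∞     | fin b = inj₂ eq

  monomial-unit : ∀ n {x y} → Normalized x y → Σ (Fin (suc n)) λ k → ν (monomial (suc n) x y (toℕ k)) ≡ fin (+ 0)
  monomial-unit n {x} nm with normalized-unit nm
  ... | inj₁ x-unit = Fin.zero , ≡.trans (ν-* _ _) (≡.cong₂ _+∞_ (ν-pow-unit n x-unit) ν-1#)
  ... | inj₂ y-unit = Fin.fromℕ n , ≡.trans (ν-* _ _)
      (≡.cong₂ _+∞_ (≡.trans (≡.cong (λ t → ν (pow K x t)) no-x) ν-1#) (ν-pow-unit (toℕ (Fin.fromℕ n)) y-unit))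
    where
    no-x : suc n ∸ suc (toℕ (Fin.fromℕ n)) ≡ 0
    no-x = ≡.trans (≡.cong (n ∸_) (Fin.toℕ-fromℕ n)) (ℕ.n∸n≡0 n)

  -- The Sylvester matrix sends the vector of monomials of degree 2D - 1, which
  -- has a unit entry, to the values of both forms times monomials; Cramer's
  -- rule then bounds the resultant.
  resultant-≤ν : ∀ {e} d (a b : Form K (suc d)) → IntegralForm a → IntegralForm b → ∀ {x y} → Normalized x y →
    e ≤∞ ν (evalForm K a x y) → e ≤∞ ν (evalForm K b x y) → e ≤∞ ν (Res K a b)
  resultant-≤ν {e} d a b a-int b-int {x} {y} nm ea eb =
    det-≤ν-of-unit-combination N M v (proj₁ unit-entry) M-integral v-integral (proj₂ unit-entry) rows
    where
    D = suc d
    N = D ℕ.+ D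
    M : Mat N
    M = sylvester K a b
    x-int = proj₁ (normalized-integral nm)
    y-int = proj₂ (normalized-integral nm)
    v : Fin N → Carrier
    v j = monomial N x y (toℕ j)
    M-integral : ∀ r s → Integral K 𝔭 (M r s)
    M-integral r s = by-block (toℕ r ℕ.<? D)
      where
      by-block : Dec (toℕ r ℕ.< D) → Integral K 𝔭 (M r s)
      by-block (yes r<D) = ≡.subst (Integral K 𝔭) (≡.sym (sylvester-upper a b r s r<D))
                             (shifted-integral a a-int (toℕ r) (toℕ s))
      by-block (no r≮D)  = ≡.subst (Integral K 𝔭) (≡.sym (sylvester-lower a b r s r≮D))
                             (shifted-integral b b-int (toℕ r ∸ D) (toℕ s))
    v-integral : ∀ j → Integral K 𝔭 (v j)
    v-integral j = ≤ν-*ˡ (integral-pow (N ∸ suc (toℕ j)) x-int) (integral-pow (toℕ j) y-int)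
    row : ∀ (f : Form K D) → IntegralForm f → e ≤∞ ν (evalForm K f x y) → ∀ i r → r ℕ.< D →
          (∀ j → M i j ≡ shifted f r (toℕ j)) → e ≤∞ ν (sumF K N (λ j → v j * M i j))
    row f f-int ef i r r<D M-row = ≤ν-resp-≈ (sym row≈) (≤ν-*ˡ (≤ν-*ˡ (integral-pow (D ∸ suc r) x-int) (integral-pow r y-int)) ef)
      where
      row≈ : sumF K N (λ j → v j * M i j) ≈ monomial D x y r * evalForm K f x y
      row≈ = trans (sum-cong N {f = λ j → v j * M i j} {g = λ j → monomial N x y (toℕ j) * shifted f r (toℕ j)}
                               (λ j → *-congˡ (reflexive (M-row j))))
             (trans (reflexive (sumF-toℕ N (λ t → monomial N x y t * shifted f r t)))
                    (sylvesterRow-monomials f r r<D x y))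
    rows : ∀ i → e ≤∞ ν (sumF K N (λ j → v j * M i j))
    rows i = by-block (toℕ i ℕ.<? D)
      where
      by-block : Dec (toℕ i ℕ.< D) → e ≤∞ ν (sumF K N (λ j → v j * M i j))
      by-block (yes i<D) = row a a-int ea i (toℕ i) i<D (λ j → sylvester-upper a b i j i<D)
      by-block (no i≮D)  = row b b-int eb i (toℕ i ∸ D) (ℕ.m<n+o⇒m∸n<o (toℕ i) D (Fin.toℕ<n i))
                             (λ j → sylvester-lower a b i j i≮D)
    unit-entry : Σ (Fin N) λ k → ν (v k) ≡ fin (+ 0)
    unit-entry = monomial-unit (d ℕ.+ D) nm

  evalForms-normalized : ∀ d (a b : Form K (suc d)) → IntegralForm a → IntegralForm b →
    ν (Res K a b) ≡ fin (+ 0) → ∀ {x y} → Normalized x y → Normalized (evalForm K a x y) (evalForm K b x y)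
  evalForms-normalized d a b a-int b-int res-unit nm = min∞-of-nonneg _ _
    (evalForm-integral a a-int x-int y-int) (evalForm-integral b b-int x-int y-int)
    (λ (in-𝔭ᵃ , in-𝔭ᵇ) → 1≰0 (≡.subst (fin (+ 1) ≤∞_) res-unit (resultant-≤ν d a b a-int b-int nm in-𝔭ᵃ in-𝔭ᵇ)))
    where
    x-int = proj₁ (normalized-integral nm)
    y-int = proj₂ (normalized-integral nm)
    1≰0 : ¬ fin (+ 1) ≤∞ fin (+ 0)
    1≰0 (fin≤fin (ℤ.+≤+ ()))

  Congruent : ℤ∞ → Carrier → Carrier → Set
  Congruent e x y = e ≤∞ ν (x - y)

  congruent-≈ : ∀ {e x y} → x ≈ y → Congruent e x y
  congruent-≈ {y = y} x≈y = ≤ν-resp-≈ (sym (trans (+-congʳ x≈y) (-‿inverseʳ y))) ≤ν-0#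

  congruent-trans : ∀ {e x y z} → Congruent e x y → Congruent e y z → Congruent e x z
  congruent-trans {x = x} {y} {z} p q =
    ≤ν-resp-≈ (solve 3 (λ x y z → (x :- y) :+ (y :- z) := x :- z) refl x y z) (≤ν-+ p q)

  congruent-+ : ∀ {e x x′ y y′} → Congruent e x x′ → Congruent e y y′ → Congruent e (x + y) (x′ + y′)
  congruent-+ {x = x} {x′} {y} {y′} p q = ≤ν-resp-≈
    (solve 4 (λ x x′ y y′ → (x :- x′) :+ (y :- y′) := (x :+ y) :- (x′ :+ y′)) refl x x′ y y′) (≤ν-+ p q)

  congruent-- : ∀ {e x x′ y y′} → Congruent e x x′ → Congruent e y y′ → Congruent e (x - y) (x′ - y′)
  congruent-- {x = x} {x′} {y} {y′} p q = ≤ν-resp-≈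
    (solve 4 (λ x x′ y y′ → (x :- x′) :- (y :- y′) := (x :- y) :- (x′ :- y′)) refl x x′ y y′) (≤ν-- p q)

  congruent-* : ∀ {e x x′ y y′} → Integral K 𝔭 x → Integral K 𝔭 y′ →
    Congruent e x x′ → Congruent e y y′ → Congruent e (x * y) (x′ * y′)
  congruent-* {x = x} {x′} {y} {y′} x-int y′-int p q = ≤ν-resp-≈
    (solve 4 (λ x x′ y y′ → x :* (y :- y′) :+ (x :- x′) :* y′ := x :* y :- x′ :* y′) refl x x′ y y′)
    (≤ν-+ (≤ν-*ˡ x-int q) (≤ν-*ʳ p y′-int))

  congruent-pow : ∀ {e x x′} n → Integral K 𝔭 x → Integral K 𝔭 x′ → Congruent e x x′ →
    Congruent e (pow K x n) (pow K x′ n)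
  congruent-pow zero    _     _      _ = congruent-≈ refl
  congruent-pow (suc n) x-int x′-int p = congruent-* x-int (integral-pow n x′-int) p (congruent-pow n x-int x′-int p)

  congruent-sum : ∀ {e} n (f g : Fin n → Carrier) → (∀ j → Congruent e (f j) (g j)) →
    Congruent e (sumF K n f) (sumF K n g)
  congruent-sum zero    f g h = congruent-≈ refl
  congruent-sum (suc n) f g h = congruent-+ (h Fin.zero) (congruent-sum n _ _ (λ j → h (Fin.suc j)))

  congruent-evalForm : ∀ {e D} (f : Form K D) → IntegralForm f → ∀ {x y x′ y′} →
    Integral K 𝔭 x → Integral K 𝔭 y → Integral K 𝔭 x′ → Integral K 𝔭 y′ →
    Congruent e x x′ → Congruent e y y′ → Congruent e (evalForm K f x y) (evalForm K f x′ y′)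
  congruent-evalForm {D = D} f f-int {x} {y} {x′} {y′} x-int y-int x′-int y′-int cx cy =
    congruent-sum (suc D) (monomialTerm f x y) (monomialTerm f x′ y′) (λ k →
      congruent-* (f-int k) (≤ν-*ˡ (integral-pow (D ∸ toℕ k) x′-int) (integral-pow (toℕ k) y′-int))
        (congruent-≈ refl)
        (congruent-* (integral-pow (D ∸ toℕ k) x-int) (integral-pow (toℕ k) y′-int)
          (congruent-pow (D ∸ toℕ k) x-int x′-int cx) (congruent-pow (toℕ k) y-int y′-int cy)))

  -- If x₁ is a unit take λ = x₂/x₁, otherwise y₁ is a unit and λ = y₂/y₁.
  proportional-mod-cross : ∀ {x₁ y₁ x₂ y₂} → Normalized x₁ y₁ → Integral K 𝔭 x₂ → Integral K 𝔭 y₂ →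
    let e = ν (x₁ * y₂ - x₂ * y₁) in
    Σ Carrier λ λ′ → Integral K 𝔭 λ′ × Congruent e x₂ (λ′ * x₁) × Congruent e y₂ (λ′ * y₁)
  proportional-mod-cross {x₁} {y₁} {x₂} {y₂} nm x₂-int y₂-int with normalized-unit nm
  ... | inj₁ x₁-unit with unit-inverse x₁-unit
  ...   | w , x₁w≈1 , w-int = x₂ * w , ≤ν-*ˡ x₂-int w-int , congruent-≈ x₂≈ , y₂≡
    where
    x₂≈ : x₂ ≈ (x₂ * w) * x₁
    x₂≈ = sym (trans (solve 3 (λ a b c → (a :* b) :* c := a :* (c :* b)) refl x₂ w x₁)
                     (trans (*-congˡ x₁w≈1) (*-identityʳ x₂)))
    y₂≡ : Congruent _ y₂ ((x₂ * w) * y₁)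
    y₂≡ = ≤ν-resp-≈ (sym (begin
      y₂ - (x₂ * w) * y₁              ≈⟨ +-congʳ (sym (trans (*-congˡ x₁w≈1) (*-identityʳ y₂))) ⟩
      y₂ * (x₁ * w) - (x₂ * w) * y₁   ≈⟨ solve 5 (λ x₁ y₁ x₂ y₂ w → y₂ :* (x₁ :* w) :- (x₂ :* w) :* y₁
                                           := (x₁ :* y₂ :- x₂ :* y₁) :* w) refl x₁ y₁ x₂ y₂ w ⟩
      (x₁ * y₂ - x₂ * y₁) * w         ∎)) (≤ν-*ʳ ≤∞-refl w-int)
  proportional-mod-cross {x₁} {y₁} {x₂} {y₂} nm x₂-int y₂-int | inj₂ y₁-unit with unit-inverse y₁-unit
  ...   | w , y₁w≈1 , w-int = y₂ * w , ≤ν-*ˡ y₂-int w-int , x₂≡ , congruent-≈ y₂≈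
    where
    y₂≈ : y₂ ≈ (y₂ * w) * y₁
    y₂≈ = sym (trans (solve 3 (λ a b c → (a :* b) :* c := a :* (c :* b)) refl y₂ w y₁)
                     (trans (*-congˡ y₁w≈1) (*-identityʳ y₂)))
    x₂≡ : Congruent _ x₂ ((y₂ * w) * x₁)
    x₂≡ = ≤ν-resp-≈ (sym (begin
      x₂ - (y₂ * w) * x₁              ≈⟨ +-congʳ (sym (trans (*-congˡ y₁w≈1) (*-identityʳ x₂))) ⟩
      x₂ * (y₁ * w) - (y₂ * w) * x₁   ≈⟨ solve 5 (λ x₁ y₁ x₂ y₂ w → x₂ :* (y₁ :* w) :- (y₂ :* w) :* x₁
                                           := (:- (x₁ :* y₂ :- x₂ :* y₁)) :* w) refl x₁ y₁ x₂ y₂ w ⟩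
      (- (x₁ * y₂ - x₂ * y₁)) * w     ∎)) (≤ν-*ʳ (≤ν-neg ≤∞-refl) w-int)

  -- Modulo Δ = x₁y₂ − x₂y₁ the point (x₂, y₂) is λ(x₁, y₁), so by homogeneity
  -- the values at it are λ^D times those at (x₁, y₁), and the cross term vanishes.
  cross-≤ν-evalForms : ∀ {D} (f g : Form K D) → IntegralForm f → IntegralForm g →
    ∀ {x₁ y₁ x₂ y₂} → Normalized x₁ y₁ → Integral K 𝔭 x₂ → Integral K 𝔭 y₂ →
    ν (x₁ * y₂ - x₂ * y₁) ≤∞
      ν (evalForm K f x₁ y₁ * evalForm K g x₂ y₂ - evalForm K f x₂ y₂ * evalForm K g x₁ y₁)
  cross-≤ν-evalForms {D} f g f-int g-int {x₁} {y₁} {x₂} {y₂} nm x₂-int y₂-int =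
    ≤ν-resp-≈ (trans (+-congˡ -0#≈0#) (+-identityʳ _)) (congruent-trans cross≡ (congruent-≈ cancel))
    where
    open import Algebra.Properties.Ring ring using (-0#≈0#)
    x₁-int = proj₁ (normalized-integral nm)
    y₁-int = proj₂ (normalized-integral nm)
    λ-data = proportional-mod-cross nm x₂-int y₂-int
    λ′   = proj₁ λ-data
    λ-int = proj₁ (proj₂ λ-data)
    Λ = pow K λ′ D
    fP = evalForm K f x₁ y₁
    gP = evalForm K g x₁ y₁
    fQ = evalForm K f x₂ y₂
    gQ = evalForm K g x₂ y₂
    at-λP : ∀ (h : Form K D) → IntegralForm h → Congruent _ (evalForm K h x₂ y₂) (Λ * evalForm K h x₁ y₁)
    at-λP h h-int = congruent-trans
      (congruent-evalForm h h-int x₂-int y₂-int (≤ν-*ˡ λ-int x₁-int) (≤ν-*ˡ λ-int y₁-int)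
        (proj₁ (proj₂ (proj₂ λ-data))) (proj₂ (proj₂ (proj₂ λ-data))))
      (congruent-≈ (evalForm-homogeneous h λ′ x₁ y₁))
    cross≡ : Congruent _ (fP * gQ - fQ * gP) (fP * (Λ * gP) - (Λ * fP) * gP)
    cross≡ = congruent--
      (congruent-* (evalForm-integral f f-int x₁-int y₁-int) (≤ν-*ˡ (integral-pow D λ-int) (evalForm-integral g g-int x₁-int y₁-int))
                   (congruent-≈ refl) (at-λP g g-int))
      (congruent-* (evalForm-integral f f-int x₂-int y₂-int) (evalForm-integral g g-int x₁-int y₁-int)
                   (at-λP f f-int) (congruent-≈ refl))
    cancel : fP * (Λ * gP) - (Λ * fP) * gP ≈ 0#
    cancel = trans (solve 3 (λ a b c → a :* (b :* c) :- (b :* a) :* c := a :* (b :* c) :- a :* (b :* c)) refl fP Λ gP)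
                   (-‿inverseʳ _)

module Projective {c ℓ} (K : NumberField c ℓ) (𝔭 : FinitePlace K) where
  open NumberField K
  open FinitePlace 𝔭
  open Solver K
  open ℤ∞-Properties
  open Valuation K 𝔭
  open Forms K using (evalForm-cong; evalForm-homogeneous)
  open FormValuation K 𝔭 using (Normalized)

  Rescaled : Pair K → Pair K → Set (c Level.⊔ ℓ)
  Rescaled (x , y) (x′ , y′) = Σ Carrier λ α → ¬ α ≈ 0# × x′ ≈ α * x × y′ ≈ α * y

  *-≉0 : ∀ {x y} → ¬ x ≈ 0# → ¬ y ≈ 0# → ¬ x * y ≈ 0#
  *-≉0 {x} {y} x≉0 y≉0 with ν-finite x≉0 | ν-finite y≉0
  ... | a , νx | b , νy = ν-fin⇒≉0 (≡.trans (ν-* x y) (≡.cong₂ _+∞_ νx νy))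

  pow-≉0 : ∀ {x} n → ¬ x ≈ 0# → ¬ pow K x n ≈ 0#
  pow-≉0 zero    x≉0 1≈0 = 0≉1 (sym 1≈0)
  pow-≉0 (suc n) x≉0     = *-≉0 x≉0 (pow-≉0 n x≉0)

  rescaled-refl : ∀ P → Rescaled P P
  rescaled-refl (x , y) = 1# , (λ 1≈0 → 0≉1 (sym 1≈0)) , sym (*-identityˡ x) , sym (*-identityˡ y)

  rescaled-trans : ∀ {P P′ P″} → Rescaled P P′ → Rescaled P′ P″ → Rescaled P P″
  rescaled-trans {x , y} (α , α≉0 , x′≈ , y′≈) (β , β≉0 , x″≈ , y″≈) = β * α , *-≉0 β≉0 α≉0
    , trans x″≈ (trans (*-congˡ x′≈) (sym (*-assoc β α x)))
    , trans y″≈ (trans (*-congˡ y′≈) (sym (*-assoc β α y)))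

  rescaled-apply : ∀ (φ : RationalMap K) {P P′} → Rescaled P P′ → Rescaled (apply K φ P) (apply K φ P′)
  rescaled-apply φ {x , y} (α , α≉0 , x′≈ , y′≈) = pow K α (suc d) , pow-≉0 (suc d) α≉0
    , trans (evalForm-cong F x′≈ y′≈) (evalForm-homogeneous F α x y)
    , trans (evalForm-cong G x′≈ y′≈) (evalForm-homogeneous G α x y)
    where open RationalMap φ

  rescaled-nonzero : ∀ {P P′} → NonZeroPair K P → Rescaled P P′ → NonZeroPair K P′
  rescaled-nonzero {x , y} P≢0 (α , α≉0 , x′≈ , y′≈) (x′≈0 , y′≈0) = P≢0 (vanishes x′≈ x′≈0 , vanishes y′≈ y′≈0)
    where
    vanishes : ∀ {z z′} → z′ ≈ α * z → z′ ≈ 0# → z ≈ 0#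
    vanishes {z} z′≈ z′≈0 with ν-finite α≉0
    ... | a , να = ν-∞⇒0 z (fin-+∞-infinite a (ν z)
                     (≡.trans (≡.cong (_+∞ ν z) (≡.sym να)) (≡.trans (≡.sym (ν-* α z)) (ν-≈0 (trans (sym z′≈) z′≈0)))))

  ∼⇒rescaled : ∀ {P P′} → NonZeroPair K P → NonZeroPair K P′ → _∼_ K P′ P → Rescaled P P′
  ∼⇒rescaled {x , y} {x′ , y′} P≢0 P′≢0 x′y≈xy′ = by-x (ν x) ≡.refl
    where
    open import Relation.Binary.Reasoning.Setoid setoid
    from : ∀ α → α * x ≈ x′ → α * y ≈ y′ → Rescaled (x , y) (x′ , y′)
    from α αx≈x′ αy≈y′ = α , α≉0 , sym αx≈x′ , sym αy≈y′
      where
      α≉0 : ¬ α ≈ 0#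
      α≉0 α≈0 = P′≢0 (trans (sym αx≈x′) (trans (*-congʳ α≈0) (zeroˡ x)) , trans (sym αy≈y′) (trans (*-congʳ α≈0) (zeroˡ y)))
    by-x : ∀ t → ν x ≡ t → Rescaled (x , y) (x′ , y′)
    by-x (fin a) νx with inverse x (ν-fin⇒≉0 νx)
    ... | w , xw≈1 = from (x′ * w)
      (trans (solve 3 (λ a b c → (a :* b) :* c := a :* (c :* b)) refl x′ w x) (trans (*-congˡ xw≈1) (*-identityʳ x′)))
      (begin
        (x′ * w) * y  ≈⟨ solve 3 (λ a b c → (a :* b) :* c := (a :* c) :* b) refl x′ w y ⟩
        (x′ * y) * w  ≈⟨ *-congʳ x′y≈xy′ ⟩
        (x * y′) * w  ≈⟨ solve 3 (λ a b c → (a :* b) :* c := b :* (a :* c)) refl x y′ w ⟩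
        y′ * (x * w)  ≈⟨ *-congˡ xw≈1 ⟩
        y′ * 1#       ≈⟨ *-identityʳ y′ ⟩
        y′            ∎)
    by-x ∞ νx with inverse y (λ y≈0 → P≢0 (ν-∞⇒0 x νx , y≈0))
    ... | w , yw≈1 = from (y′ * w)
      (begin
        (y′ * w) * x      ≈⟨ *-congˡ x≈0 ⟩
        (y′ * w) * 0#     ≈⟨ zeroʳ _ ⟩
        0#                ≈⟨ zeroʳ w ⟨
        w * 0#            ≈⟨ *-congˡ (trans (*-congʳ x≈0) (zeroˡ y′)) ⟨
        w * (x * y′)      ≈⟨ *-congˡ x′y≈xy′ ⟨
        w * (x′ * y)      ≈⟨ solve 3 (λ a b c → c :* (a :* b) := a :* (b :* c)) refl x′ y w ⟩
        x′ * (y * w)      ≈⟨ *-congˡ yw≈1 ⟩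
        x′ * 1#           ≈⟨ *-identityʳ x′ ⟩
        x′                ∎)
      (trans (solve 3 (λ a b c → (a :* b) :* c := a :* (c :* b)) refl y′ w y) (trans (*-congˡ yw≈1) (*-identityʳ y′)))
      where x≈0 = ν-∞⇒0 x νx

  min-ν-finite : ∀ {x y} → NonZeroPair K (x , y) → ∃ λ c → min∞ (ν x) (ν y) ≡ fin c
  min-ν-finite {x} {y} P≢0 with ν x in νx | ν y in νy
  ... | fin a | fin b = a ℤ.⊓ b , ≡.refl
  ... | fin a | ∞     = a , ≡.refl
  ... | ∞     | fin b = b , ≡.refl
  ... | ∞     | ∞     = ⊥-elim (P≢0 (ν-∞⇒0 x νx , ν-∞⇒0 y νy))

  ν-scaled : ∀ {α a z z′} → ν α ≡ fin a → z′ ≈ α * z → ν z′ ≡ (fin a +∞ ν z)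
  ν-scaled {α} {z = z} να z′≈ = ≡.trans (ν-cong z′≈) (≡.trans (ν-* α z) (≡.cong (_+∞ ν z) να))

  min-ν-scaled : ∀ {α a x y x′ y′} → ν α ≡ fin a → x′ ≈ α * x → y′ ≈ α * y →
    min∞ (ν x′) (ν y′) ≡ (fin a +∞ min∞ (ν x) (ν y))
  min-ν-scaled {a = a} {x} {y} να x′≈ y′≈ =
    ≡.trans (≡.cong₂ min∞ (ν-scaled να x′≈) (ν-scaled να y′≈)) (+∞-distribˡ-min∞ a (ν x) (ν y))

  ν-cross-scaled : ∀ {α β a b x₁ y₁ x₂ y₂ x₁′ y₁′ x₂′ y₂′} → ν α ≡ fin a → ν β ≡ fin b →
    x₁′ ≈ α * x₁ → y₁′ ≈ α * y₁ → x₂′ ≈ β * x₂ → y₂′ ≈ β * y₂ →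
    ν (x₁′ * y₂′ - x₂′ * y₁′) ≡ (fin a +∞ (fin b +∞ ν (x₁ * y₂ - x₂ * y₁)))
  ν-cross-scaled {α} {β} {x₁ = x₁} {y₁} {x₂} {y₂} να νβ x₁′≈ y₁′≈ x₂′≈ y₂′≈ =
    ≡.trans (ν-scaled να (trans (+-cong (*-cong x₁′≈ y₂′≈) (-‿cong (*-cong x₂′≈ y₁′≈)))
      (solve 6 (λ α β x₁ y₁ x₂ y₂ → (α :* x₁) :* (β :* y₂) :- (β :* x₂) :* (α :* y₁)
                                    := α :* (β :* (x₁ :* y₂ :- x₂ :* y₁))) refl α β x₁ y₁ x₂ y₂)))
      (≡.cong (_ +∞_) (ν-scaled νβ refl))

  δ-rescaled : ∀ {P Q P′ Q′} → NonZeroPair K P → NonZeroPair K Q → Rescaled P P′ → Rescaled Q Q′ →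
    δ K 𝔭 P′ Q′ ≡ δ K 𝔭 P Q
  δ-rescaled {x₁ , y₁} {x₂ , y₂} {x₁′ , y₁′} {x₂′ , y₂′} P≢0 Q≢0
             (α , α≉0 , x₁′≈ , y₁′≈) (β , β≉0 , x₂′≈ , y₂′≈)
    with ν-finite α≉0 | ν-finite β≉0 | min-ν-finite P≢0 | min-ν-finite Q≢0
  ... | a , να | b , νβ | c₁ , min₁ | c₂ , min₂ = begin
      (ν (x₁′ * y₂′ - x₂′ * y₁′) -∞ min∞ (ν x₁′) (ν y₁′)) -∞ min∞ (ν x₂′) (ν y₂′)
        ≡⟨ ≡.cong₂ _-∞_ (≡.cong₂ _-∞_ (ν-cross-scaled να νβ x₁′≈ y₁′≈ x₂′≈ y₂′≈)
                                       (≡.trans (min-ν-scaled να x₁′≈ y₁′≈) (≡.cong (fin a +∞_) min₁)))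
                        (≡.trans (min-ν-scaled νβ x₂′≈ y₂′≈) (≡.cong (fin b +∞_) min₂)) ⟩
      ((fin a +∞ (fin b +∞ t)) -∞ (fin a +∞ fin c₁)) -∞ (fin b +∞ fin c₂)
        ≡⟨ -∞-shift a b t c₁ c₂ ⟩
      (t -∞ fin c₁) -∞ fin c₂
        ≡⟨ ≡.cong₂ (λ u w → (t -∞ u) -∞ w) min₁ min₂ ⟨
      (t -∞ min∞ (ν x₁) (ν y₁)) -∞ min∞ (ν x₂) (ν y₂) ∎
    where
    open ≡.≡-Reasoning
    t = ν (x₁ * y₂ - x₂ * y₁)

  δ-normalized : ∀ {x₁ y₁ x₂ y₂} → Normalized x₁ y₁ → Normalized x₂ y₂ →
    δ K 𝔭 (x₁ , y₁) (x₂ , y₂) ≡ ν (x₁ * y₂ - x₂ * y₁)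
  δ-normalized {x₁} {y₁} {x₂} {y₂} nm₁ nm₂ =
    ≡.trans (≡.cong₂ (λ u w → (ν (x₁ * y₂ - x₂ * y₁) -∞ u) -∞ w) nm₁ nm₂) (-∞-zero _)

  normalized-nonzero : ∀ {x y} → Normalized x y → NonZeroPair K (x , y)
  normalized-nonzero nm (x≈0 , y≈0) with ≡.trans (≡.sym nm) (≡.cong₂ min∞ (ν-≈0 x≈0) (ν-≈0 y≈0))
  ... | ()

  -- Divide by an element whose valuation is min(ν x, ν y).
  normalize : ∀ {P} → NonZeroPair K P → Σ (Pair K) λ P₀ → Normalized (proj₁ P₀) (proj₂ P₀) × Rescaled P₀ P
  normalize {x , y} P≢0 with min-ν-finite P≢0
  ... | c , min≡c with ν-surj c
  ...   | α , να with inverse α (ν-fin⇒≉0 να)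
  ...     | w , αw≈1 with +∞-unit⇒fin {ν α} {ν w} (ν-inverse αw≈1)
  ...       | t , νw = (w * x , w * y) , normalized , α , ν-fin⇒≉0 να , sym (undo x) , sym (undo y)
    where
    undo : ∀ z → α * (w * z) ≈ z
    undo z = trans (sym (*-assoc α w z)) (trans (*-congʳ αw≈1) (*-identityˡ z))
    c+t≡0 : c ℤ.+ t ≡ + 0
    c+t≡0 = fin-injective (≡.trans (≡.cong₂ _+∞_ (≡.sym να) (≡.sym νw)) (ν-inverse αw≈1))
    normalized : Normalized (w * x) (w * y)
    normalized = ≡.trans (min-ν-scaled νw refl refl)
      (≡.trans (≡.cong (fin t +∞_) min≡c) (≡.cong fin (≡.trans (ℤ.+-comm t c) c+t≡0)))

module GoodMap {c ℓ} (K : NumberField c ℓ) (𝔭 : FinitePlace K) (φ : RationalMap K) (good : GoodReduction K 𝔭 φ) where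
  open NumberField K
  open FinitePlace 𝔭
  open RationalMap φ
  open ℤ∞-Properties
  open Forms K using (evalForm-cong; evalForm-scale; evalForm-homogeneous)
  open FormValuation K 𝔭
  open Projective K 𝔭

  private
    s : Carrier
    s = proj₁ good
    s≉0 : ¬ s ≈ 0#
    s≉0 = proj₁ (proj₂ good)
    s⁻¹ : Carrier
    s⁻¹ = proj₁ (inverse s s≉0)
    ss⁻¹≈1 : s * s⁻¹ ≈ 1#
    ss⁻¹≈1 = proj₂ (inverse s s≉0)

  F′ G′ : Form K (suc d)
  F′ k = s * F k
  G′ k = s * G k

  F′-integral : IntegralForm F′
  F′-integral k = proj₁ (proj₁ (proj₂ (proj₂ good)) k)

  G′-integral : IntegralForm G′
  G′-integral k = proj₂ (proj₁ (proj₂ (proj₂ good)) k)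

  reduced : Pair K → Pair K
  reduced (x , y) = evalForm K F′ x y , evalForm K G′ x y

  reduced-normalized : ∀ {x y} → Normalized x y → Normalized (proj₁ (reduced (x , y))) (proj₂ (reduced (x , y)))
  reduced-normalized = evalForms-normalized d F′ G′ F′-integral G′-integral (proj₂ (proj₂ (proj₂ good)))

  rescaled-reduced : ∀ {P₀ P} → Rescaled P₀ P → Rescaled (reduced P₀) (apply K φ P)
  rescaled-reduced {x₀ , y₀} (α , α≉0 , x≈ , y≈) =
    pow K α (suc d) * s⁻¹ , *-≉0 (pow-≉0 (suc d) α≉0) s⁻¹≉0 , value F x≈ y≈ , value G x≈ y≈
    where
    s⁻¹≉0 : ¬ s⁻¹ ≈ 0#
    s⁻¹≉0 s⁻¹≈0 = 0≉1 (trans (sym (zeroʳ s)) (trans (*-congˡ (sym s⁻¹≈0)) ss⁻¹≈1))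
    value : ∀ f {x y} → x ≈ α * x₀ → y ≈ α * y₀ →
      evalForm K f x y ≈ (pow K α (suc d) * s⁻¹) * evalForm K (λ k → s * f k) x₀ y₀
    value f x≈ y≈ = begin
      evalForm K f _ _                                           ≈⟨ evalForm-cong f x≈ y≈ ⟩
      evalForm K f (α * x₀) (α * y₀)                             ≈⟨ evalForm-homogeneous f α x₀ y₀ ⟩
      pow K α (suc d) * evalForm K f x₀ y₀                       ≈⟨ *-congˡ (*-identityˡ _) ⟨
      pow K α (suc d) * (1# * evalForm K f x₀ y₀)                ≈⟨ *-congˡ (*-congʳ (trans (*-comm s⁻¹ s) ss⁻¹≈1)) ⟨
      pow K α (suc d) * ((s⁻¹ * s) * evalForm K f x₀ y₀)         ≈⟨ *-congˡ (*-assoc _ _ _) ⟩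
      pow K α (suc d) * (s⁻¹ * (s * evalForm K f x₀ y₀))         ≈⟨ *-congˡ (*-congˡ (evalForm-scale f s x₀ y₀)) ⟨
      pow K α (suc d) * (s⁻¹ * evalForm K (λ k → s * f k) x₀ y₀) ≈⟨ *-assoc _ _ _ ⟨
      (pow K α (suc d) * s⁻¹) * evalForm K (λ k → s * f k) x₀ y₀ ∎
      where open import Relation.Binary.Reasoning.Setoid setoid

  apply-nonzero : ∀ {P} → NonZeroPair K P → NonZeroPair K (apply K φ P)
  apply-nonzero P≢0 with normalize P≢0
  ... | P₀ , nm , P₀~P = rescaled-nonzero (normalized-nonzero (reduced-normalized nm)) (rescaled-reduced P₀~P)

  δ-≤-apply : ∀ {P Q} → NonZeroPair K P → NonZeroPair K Q → δ K 𝔭 P Q ≤∞ δ K 𝔭 (apply K φ P) (apply K φ Q)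
  δ-≤-apply {P} {Q} P≢0 Q≢0 with normalize P≢0 | normalize Q≢0
  ... | (x₁ , y₁) , nm₁ , P₀~P | (x₂ , y₂) , nm₂ , Q₀~Q = begin
      δ K 𝔭 P Q                             ≡⟨ δ-rescaled (normalized-nonzero nm₁) (normalized-nonzero nm₂) P₀~P Q₀~Q ⟩
      δ K 𝔭 (x₁ , y₁) (x₂ , y₂)             ≡⟨ δ-normalized nm₁ nm₂ ⟩
      ν (x₁ * y₂ - x₂ * y₁)                 ≤⟨ cross-≤ν-evalForms F′ G′ F′-integral G′-integral nm₁
                                                  (proj₁ (normalized-integral nm₂)) (proj₂ (normalized-integral nm₂)) ⟩
      ν (proj₁ R₁ * proj₂ R₂ - proj₁ R₂ * proj₂ R₁)   ≡⟨ δ-normalized (reduced-normalized nm₁) (reduced-normalized nm₂) ⟨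
      δ K 𝔭 R₁ R₂                           ≡⟨ δ-rescaled (normalized-nonzero (reduced-normalized nm₁))
                                                  (normalized-nonzero (reduced-normalized nm₂))
                                                  (rescaled-reduced P₀~P) (rescaled-reduced Q₀~Q) ⟨
      δ K 𝔭 (apply K φ P) (apply K φ Q)     ∎
    where
    open import Relation.Binary.Reasoning.PartialOrder ≤∞-poset
    R₁ = reduced (x₁ , y₁)
    R₂ = reduced (x₂ , y₂)

module Orbits {c ℓ} (K : NumberField c ℓ) (𝔭 : FinitePlace K) (f : Pair K → Pair K)
  (f-nonzero  : ∀ {P} → NonZeroPair K P → NonZeroPair K (f P))
  (f-rescaled : ∀ {P P′} → Projective.Rescaled K 𝔭 P P′ → Projective.Rescaled K 𝔭 (f P) (f P′)) where
  open ℤ∞-Properties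
  open Projective K 𝔭

  iterate-+ : ∀ m n P → iterate K f (m ℕ.+ n) P ≡ iterate K f m (iterate K f n P)
  iterate-+ zero    n P = ≡.refl
  iterate-+ (suc m) n P = ≡.cong f (iterate-+ m n P)

  iterate-suc : ∀ k P → iterate K f (suc k) P ≡ iterate K f k (f P)
  iterate-suc zero    P = ≡.refl
  iterate-suc (suc k) P = ≡.cong f (iterate-suc k P)

  iterate-nonzero : ∀ k {P} → NonZeroPair K P → NonZeroPair K (iterate K f k P)
  iterate-nonzero zero    P≢0 = P≢0
  iterate-nonzero (suc k) P≢0 = f-nonzero (iterate-nonzero k P≢0)

  iterate-rescaled : ∀ k {P P′} → Rescaled P P′ → Rescaled (iterate K f k P) (iterate K f k P′)
  iterate-rescaled zero    P~P′ = P~P′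
  iterate-rescaled (suc k) P~P′ = f-rescaled (iterate-rescaled k P~P′)

  δ-≤-iterate : (∀ {P Q} → NonZeroPair K P → NonZeroPair K Q → δ K 𝔭 P Q ≤∞ δ K 𝔭 (f P) (f Q)) →
    ∀ k {P Q} → NonZeroPair K P → NonZeroPair K Q → δ K 𝔭 P Q ≤∞ δ K 𝔭 (iterate K f k P) (iterate K f k Q)
  δ-≤-iterate δ-≤-f zero    P≢0 Q≢0 = ≤∞-refl
  δ-≤-iterate δ-≤-f (suc k) P≢0 Q≢0 = ≤∞-trans (δ-≤-iterate δ-≤-f k P≢0 Q≢0)
    (δ-≤-f (iterate-nonzero k P≢0) (iterate-nonzero k Q≢0))

  periodic-rescaled : ∀ {P} n → NonZeroPair K P → _∼_ K (iterate K f (suc n) P) P →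
    ∀ k → Rescaled P (iterate K f (k ℕ.* suc n) P)
  periodic-rescaled n P≢0 period zero    = rescaled-refl _
  periodic-rescaled {P} n P≢0 period (suc k) = ≡.subst (Rescaled P) (≡.sym (iterate-+ (suc n) (k ℕ.* suc n) P))
    (rescaled-trans (∼⇒rescaled P≢0 (iterate-nonzero (suc n) P≢0) period)
                    (iterate-rescaled (suc n) (periodic-rescaled n P≢0 period k)))

module Composite {c ℓ} (K : NumberField c ℓ) (𝔭 : FinitePlace K) (φ ψ : RationalMap K)
  (good-φ : GoodReduction K 𝔭 φ) (good-ψ : GoodReduction K 𝔭 ψ) where
  open ℤ∞-Properties
  open Projective K 𝔭
  private
    module φ = GoodMap K 𝔭 φ good-φ
    module ψ = GoodMap K 𝔭 ψ good-ψ

  Φ : Pair K → Pair K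
  Φ R = apply K ψ (apply K φ R)

  Φ-nonzero : ∀ {R} → NonZeroPair K R → NonZeroPair K (Φ R)
  Φ-nonzero R≢0 = ψ.apply-nonzero (φ.apply-nonzero R≢0)

  Φ-rescaled : ∀ {R R′} → Rescaled R R′ → Rescaled (Φ R) (Φ R′)
  Φ-rescaled R~R′ = rescaled-apply ψ (rescaled-apply φ R~R′)

  δ-≤-φ-Φ : ∀ {R S} → NonZeroPair K R → NonZeroPair K S →
    δ K 𝔭 R S ≤∞ δ K 𝔭 (apply K φ R) (apply K φ S) × δ K 𝔭 (apply K φ R) (apply K φ S) ≤∞ δ K 𝔭 (Φ R) (Φ S)
  δ-≤-φ-Φ R≢0 S≢0 = φ.δ-≤-apply R≢0 S≢0 , ψ.δ-≤-apply (φ.apply-nonzero R≢0) (φ.apply-nonzero S≢0)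

  δ-≤-Φ : ∀ {R S} → NonZeroPair K R → NonZeroPair K S → δ K 𝔭 R S ≤∞ δ K 𝔭 (Φ R) (Φ S)
  δ-≤-Φ R≢0 S≢0 = ≤∞-trans (proj₁ (δ-≤-φ-Φ R≢0 S≢0)) (proj₂ (δ-≤-φ-Φ R≢0 S≢0))

  open Orbits K 𝔭 Φ Φ-nonzero Φ-rescaled public

lemma2p3 : ∀ {c ℓ} (K : NumberField c ℓ) (𝔭 : FinitePlace K)
    (φ ψ : RationalMap K) →
    GoodReduction K 𝔭 φ → GoodReduction K 𝔭 ψ →
    (P Q : Pair K) → NonZeroPair K P → NonZeroPair K Q →
    Periodic K (λ R → apply K ψ (apply K φ R)) P →
    Periodic K (λ R → apply K ψ (apply K φ R)) Q →
    δ K 𝔭 P Q ≡ δ K 𝔭 (apply K φ P) (apply K φ Q)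
lemma2p3 K 𝔭 φ ψ good-φ good-ψ P Q P≢0 Q≢0 (n , P-period) (m , Q-period) =
  ≤∞-antisym (proj₁ (δ-≤-φ-Φ P≢0 Q≢0)) (begin
    δ K 𝔭 (apply K φ P) (apply K φ Q)                     ≤⟨ proj₂ (δ-≤-φ-Φ P≢0 Q≢0) ⟩
    δ K 𝔭 (Φ P) (Φ Q)                                     ≤⟨ δ-≤-iterate δ-≤-Φ N (Φ-nonzero P≢0) (Φ-nonzero Q≢0) ⟩
    δ K 𝔭 (iterate K Φ N (Φ P)) (iterate K Φ N (Φ Q))     ≡⟨ ≡.cong₂ (δ K 𝔭) (iterate-suc N P) (iterate-suc N Q) ⟨
    δ K 𝔭 (iterate K Φ (suc N) P) (iterate K Φ (suc N) Q) ≡⟨ δ-rescaled P≢0 Q≢0 P-returns Q-returns ⟩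
    δ K 𝔭 P Q                                             ∎)
  where
  open ℤ∞-Properties
  open Projective K 𝔭
  open Composite K 𝔭 φ ψ good-φ good-ψ
  open import Relation.Binary.Reasoning.PartialOrder ≤∞-poset
  -- suc N = (n + 1)(m + 1), a common period of P and Q.
  N : ℕ
  N = m ℕ.+ n ℕ.* suc m
  P-returns : Rescaled P (iterate K Φ (suc N) P)
  P-returns = ≡.subst (λ t → Rescaled P (iterate K Φ t P)) (ℕ.*-comm (suc m) (suc n))
    (periodic-rescaled n P≢0 P-period (suc m))
  Q-returns : Rescaled Q (iterate K Φ (suc N) Q)
  Q-returns = periodic-rescaled m Q≢0 Q-period (suc n)
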